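{- For every fixed positive integer $k$ there is a transducer $T$ such that, for every $321$-avoiding permutation $\pi$ and every staircase gridding $\pi^\sharp$ of $\pi$ with at most $k$ entries in each cell, on input the domino encoding $\delta(\pi^\sharp)$ the transducer $T$ outputs the Dyck path encoding of $\pi$.
   Context: A staircase gridding of a $321$-avoiding permutation $\pi$ is a partition of its entries into cells labelled by the positive integers such that: entries in each cell are increasing; for $i\ge1$ all entries in cell $2i$ lie to the right of those in cell $2i-1$; for $i\ge1$ all entries in cell $2i+1$ lie above those in cell $2i$; if $j\ge i+2$ all entries in cell $j$ lie above and to the right of those in cell $i$ (griddings need not be greedy). For $i\ge 0$, the $i$th domino factor $d_i$ records the cell labels of the entries of cells $i$ and $i+1$ (cell $0$ is empty), read from bottom to top (by value) if $i$ is odd and from left to right (by position) if $i$ is even; $d_i^{\bullet}$ is obtained from $d_i$ by replacing each $i$ by $\circ$ and each $i+1$ by $\bullet$. The domino encoding is $\delta(\pi^\sharp)=d_0^\bullet\#d_1^\bullet\#\cdots\#d_m^\bullet\#$, where $m$ is the largest label of a nonempty cell. If $\pi$ has length $n$ and its left-to-right maxima (entries larger than all entries to their left) are at positions $i_1<\dots<i_k$ with values $v_1<\dots<v_k$, its Dyck path encoding is the word $\mathsf{u}^{v_1}\mathsf{d}^{i_2-i_1}\mathsf{u}^{v_2-v_1}\mathsf{d}^{i_3-i_2}\cdots\mathsf{u}^{v_k-v_{k-1}}\mathsf{d}^{n+1-i_k}$ over $\{\mathsf{u},\mathsf{d}\}$. A transducer is a finite-state automaton (possibly nondeterministic) each of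 whose transitions carries an input symbol (or the empty word) and an output symbol (or the empty word); the output of an accepting computation is the concatenation of output symbols of its transitions. -}

module Defs where

open import Data.Nat using (ℕ; zero; suc; _+_; _*_; _∸_; _≤_; _<_; _<ᵇ_; _⊔_)
open import Data.Fin using (Fin; toℕ)
import Data.Fin as F
open import Data.Bool using (Bool; true; false; not; _∨_; _∧_)
open import Data.List using (List; []; _∷_; _++_; map; concat; concatMap; allFin;
  filterᵇ; length; replicate; foldr; fromMaybe; upTo)
open import Data.Maybe using (Maybe)
open import Data.Product using (Σ; _×_; _,_)
open import Data.Nat using (_≡ᵇ_)
open import Relation.Binary.PropositionalEquality using (_≡_)
open import Data.List.Membership.Propositional using (_∈_)
open import Function.Definitions using (Injective)

-- Permutations of length n: injective maps σ : Fin n → Fin n.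
-- Position p (0-based Fin) is position toℕ p + 1; its entry has value
-- toℕ (σ p) + 1 (1-based, as in the paper).

IsPerm : (n : ℕ) → (Fin n → Fin n) → Set
IsPerm n σ = Injective _≡_ _≡_ σ

Avoids321 : (n : ℕ) → (Fin n → Fin n) → Set
Avoids321 n σ = (a b c : Fin n) → a F.< b → b F.< c →
  σ b F.< σ a → σ c F.< σ b → Data.Empty.⊥
  where import Data.Empty

-- Staircase gridding: a labelling g : Fin n → ℕ of entries by cells
-- (positive integers).

record StaircaseGridding (n : ℕ) (σ : Fin n → Fin n) (g : Fin n → ℕ) : Set where
  field
    positive   : (p : Fin n) → 1 ≤ g p
    increasing : (p q : Fin n) → g p ≡ g q → p F.< q → σ p F.< σ q
    evenRight  : (i : ℕ) → 1 ≤ i → (p q : Fin n) →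
                 g p ≡ 2 * i ∸ 1 → g q ≡ 2 * i → p F.< q
    oddAbove   : (i : ℕ) → 1 ≤ i → (p q : Fin n) →
                 g p ≡ 2 * i → g q ≡ 2 * i + 1 → σ p F.< σ q
    farAboveRight : (i j : ℕ) → i + 2 ≤ j → (p q : Fin n) →
                 g p ≡ i → g q ≡ j → (p F.< q) × (σ p F.< σ q)

cellSize : (n : ℕ) → (Fin n → ℕ) → ℕ → ℕ
cellSize n g c = length (filterᵇ (λ p → g p ≡ᵇ c) (allFin n))

data DSym : Set where
  ○ ● ♯ : DSym

byPosition : (n : ℕ) → List (Fin n)
byPosition n = allFin n

byValue : (n : ℕ) → (Fin n → Fin n) → List (Fin n)
byValue n σ = concatMap (λ v → filterᵇ (λ p → toℕ (σ p) ≡ᵇ toℕ v) (allFin n)) (allFin n)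

isEven : ℕ → Bool
isEven zero = true
isEven (suc k) = not (isEven k)

domino : (n : ℕ) → (Fin n → Fin n) → (Fin n → ℕ) → ℕ → List DSym
domino n σ g i =
  map (λ p → if g p ≡ᵇ i then ○ else ●)
      (filterᵇ (λ p → (g p ≡ᵇ i) ∨ (g p ≡ᵇ suc i)) order)
  where
    open import Data.Bool using (if_then_else_)
    order : List (Fin n)
    order = if isEven i then byPosition n else byValue n σ

-- m : the largest label of a nonempty cell (0 if there are no entries)
maxLabel : (n : ℕ) → (Fin n → ℕ) → ℕ
maxLabel n g = foldr _⊔_ 0 (map g (allFin n))

dominoEncoding : (n : ℕ) → (Fin n → Fin n) → (Fin n → ℕ) → List DSym
dominoEncoding n σ g =
  concatMap (λ i → domino n σ g i ++ (♯ ∷ [])) (upTo (suc (maxLabel n g)))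

data UD : Set where
  u d : UD

allᵇ : {A : Set} → (A → Bool) → List A → Bool
allᵇ P [] = true
allᵇ P (x ∷ xs) = P x ∧ allᵇ P xs

isLTRMax : (n : ℕ) → (Fin n → Fin n) → Fin n → Bool
isLTRMax n σ p =
  allᵇ (λ q → not (toℕ q <ᵇ toℕ p) ∨ (toℕ (σ q) <ᵇ toℕ (σ p))) (allFin n)

ltrMaxima : (n : ℕ) → (Fin n → Fin n) → List (ℕ × ℕ)
ltrMaxima n σ =
  map (λ p → (suc (toℕ p) , suc (toℕ (σ p)))) (filterᵇ (isLTRMax n σ) (allFin n))

-- u^{v_1 - v_0} d^{i_2 - i_1} u^{v_2 - v_1} ⋯ u^{v_k - v_{k-1}} d^{n+1-i_k}, v_0 = 0
dyckWord : (n : ℕ) → ℕ → List (ℕ × ℕ) → List UD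
dyckWord n prev [] = []
dyckWord n prev ((i , v) ∷ []) = replicate (v ∸ prev) u ++ replicate (suc n ∸ i) d
dyckWord n prev ((i , v) ∷ (i′ , v′) ∷ rest) =
  replicate (v ∸ prev) u ++ replicate (i′ ∸ i) d ++ dyckWord n v ((i′ , v′) ∷ rest)

dyckEncoding : (n : ℕ) → (Fin n → Fin n) → List UD
dyckEncoding n σ = dyckWord n 0 (ltrMaxima n σ)

-- Transducers: finite state set Fin states, one initial state, a set of
-- accepting states, and a finite list of transitions each labelled by an
-- input symbol or ε (nothing) and an output symbol or ε (nothing).

record Transducer (A B : Set) : Set₁ where
  field
    states      : ℕ
    initial     : Fin states
    accepting   : Fin states → Set
    transitions : List (Fin states × Maybe A × Maybe B × Fin states)

module _ {A B : Set} (T : Transducer A B) where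
  open Transducer T

  data Run : Fin states → List A → List B → Fin states → Set where
    done : ∀ {q} → Run q [] [] q
    step : ∀ {q a b q₁ w o q′} → (q , a , b , q₁) ∈ transitions →
           Run q₁ w o q′ → Run q (fromMaybe a ++ w) (fromMaybe b ++ o) q′

  Outputs : List A → List B → Set
  Outputs w o = Σ (Fin states) λ q → Run initial w o q × accepting q

module Submission where

-- The Dyck encoding is the walk of the values of π read left
-- to right: each entry climbs to its value if that exceeds the maximum so far,
-- then steps down once (dyckEncoding-walk).  Group the cells into blocks
-- {2i, 2i+1}: the staircase conditions make the blocks consecutive by
-- position, d_{2i} lists block i by position, and its values are base i (the
-- number of entries below cell 2i-1) plus numbers read off d_{2i-1} and
-- d_{2i+1} (block-values).  Walks are invariant under shifting values, so a
-- machine storing d_{2i-1}, d_{2i} and the height relative to base i, all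
-- bounded by 2k, writes the walk block by block (Simulation); a deterministic
-- machine with finitely many states is a transducer (SequentialMachine).

open import Defs
open import Data.Nat using (ℕ; zero; suc; _+_; _*_; _∸_; _⊔_; _⊓_; _≤_; _<_; z≤n; s≤s; _<ᵇ_; _≡ᵇ_)
import Data.Nat as ℕ
open import Data.Nat.Properties
open import Data.Bool using (Bool; true; false; if_then_else_; not; _∧_; _∨_)
open import Data.Bool.Properties using (∧-assoc; ∧-comm; ∨-zeroʳ; not-involutive; T-≡)
open import Function.Bundles using (Equivalence)
open import Data.Fin using (Fin; toℕ)
import Data.Fin as F
import Data.Fin.Properties as FinP
open import Data.List using (List; []; _∷_; [_]; _++_; map; concatMap; length; filterᵇ; replicate; allFin; tabulate;
  lookup; drop; take; upTo; applyUpTo; foldr)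
open import Data.List.Properties using (∷-injective; ++-assoc; ++-identityʳ; length-++; length-map; length-take;
  length-tabulate; map-++; map-∘; map-tabulate; take-all; ≡-dec; map-concatMap; concatMap-cong; concatMap-map; concatMap-pure)
open import Data.Maybe using (Maybe; just; nothing)
open import Data.Product using (Σ; _×_; _,_; proj₁; proj₂)
open import Data.Sum using (_⊎_; inj₁; inj₂)
open import Data.Unit using (⊤; tt)
open import Data.Empty using (⊥; ⊥-elim)
open import Function.Definitions using (Injective)
open import Relation.Binary.PropositionalEquality hiding ([_])
open import Relation.Binary.Definitions using (DecidableEquality; tri<; tri≈; tri>)
open import Relation.Nullary using (yes; no)
open import Relation.Nullary.Decidable using (T?)
open import Function.Base using (_∘_)
open import Data.List.Membership.Propositional using (_∈_)
import Data.List.Membership.Propositional.Properties as ∈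
open import Data.List.Membership.Propositional.Properties
  using (∈-allFin; ∈-upTo⁺; ∈-++⁺ˡ; ∈-++⁺ʳ; ∈-map⁺; ∈-map⁻; ∈-concatMap⁺; ∈-concatMap⁻)
open import Data.List.Relation.Unary.Any as Any using (here; there; satisfied)
open import Data.List.Relation.Unary.All as All using (All; []; _∷_)
import Data.List.Relation.Unary.All.Properties as All
open import Data.List.Relation.Unary.AllPairs as AllPairs using (AllPairs; []; _∷_)
import Data.List.Relation.Unary.AllPairs.Properties as AllPairs

private
  variable
    X : Set

<ᵇ-true : ∀ {m n} → m < n → (m <ᵇ n) ≡ true
<ᵇ-true m<n = Equivalence.to T-≡ (<⇒<ᵇ m<n)

<ᵇ-true⁻ : ∀ m n → (m <ᵇ n) ≡ true → m < n
<ᵇ-true⁻ m n e = <ᵇ⇒< m n (Equivalence.from T-≡ e)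

<ᵇ-false : ∀ {m n} → n ≤ m → (m <ᵇ n) ≡ false
<ᵇ-false {m}     {zero}  _       = refl
<ᵇ-false {suc m} {suc n} (s≤s p) = <ᵇ-false p

<ᵇ-false⁻ : ∀ m n → (m <ᵇ n) ≡ false → n ≤ m
<ᵇ-false⁻ m       zero    e = z≤n
<ᵇ-false⁻ (suc m) (suc n) e = s≤s (<ᵇ-false⁻ m n e)

≡ᵇ-true : ∀ m n → m ≡ n → (m ≡ᵇ n) ≡ true
≡ᵇ-true m n e = Equivalence.to T-≡ (≡⇒≡ᵇ m n e)

≡ᵇ-true⁻ : ∀ m n → (m ≡ᵇ n) ≡ true → m ≡ n
≡ᵇ-true⁻ m n e = ≡ᵇ⇒≡ m n (Equivalence.from T-≡ e)

filter-accept : (P : X → Bool) {x : X} (xs : List X) → P x ≡ true → filterᵇ P (x ∷ xs) ≡ x ∷ filterᵇ P xs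
filter-accept P xs e rewrite e = refl

filter-reject : (P : X → Bool) {x : X} (xs : List X) → P x ≡ false → filterᵇ P (x ∷ xs) ≡ filterᵇ P xs
filter-reject P xs e rewrite e = refl

filter-all : (P : X → Bool) (xs : List X) → All (λ x → P x ≡ true) xs → filterᵇ P xs ≡ xs
filter-all P []       []       = refl
filter-all P (x ∷ xs) (px ∷ a) rewrite px = cong (x ∷_) (filter-all P xs a)

filter-none : (P : X → Bool) (xs : List X) → All (λ x → P x ≡ false) xs → filterᵇ P xs ≡ []
filter-none P []       []       = refl
filter-none P (x ∷ xs) (px ∷ a) rewrite px = filter-none P xs a

filter-satisfies : (P : X → Bool) (xs : List X) → All (λ x → P x ≡ true) (filterᵇ P xs)
filter-satisfies P []       = []
filter-satisfies P (x ∷ xs) with P x in eq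
... | true  = eq ∷ filter-satisfies P xs
... | false = filter-satisfies P xs

filter-cong : (P Q : X → Bool) (xs : List X) → All (λ x → P x ≡ Q x) xs → filterᵇ P xs ≡ filterᵇ Q xs
filter-cong P Q []       []      = refl
filter-cong P Q (x ∷ xs) (e ∷ a) with P x | Q x
... | true  | true  = cong (x ∷_) (filter-cong P Q xs a)
... | false | false = filter-cong P Q xs a
filter-cong P Q (x ∷ xs) (() ∷ a) | true  | false
filter-cong P Q (x ∷ xs) (() ∷ a) | false | true

filter-filter : (P Q : X → Bool) (xs : List X) → filterᵇ Q (filterᵇ P xs) ≡ filterᵇ (λ x → P x ∧ Q x) xs
filter-filter P Q [] = refl
filter-filter P Q (x ∷ xs) with P x
... | false = filter-filter P Q xs
... | true with Q x
...   | true  = cong (x ∷_) (filter-filter P Q xs)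
...   | false = filter-filter P Q xs

filter-weaker : (P Q : X → Bool) (xs : List X) → (∀ x → Q x ≡ true → P x ≡ true) →
                filterᵇ Q (filterᵇ P xs) ≡ filterᵇ Q xs
filter-weaker P Q xs Q⇒P = trans (filter-filter P Q xs) (filter-cong _ Q xs (All.tabulate λ {x} _ → lemma x))
  where
    lemma : ∀ x → (P x ∧ Q x) ≡ Q x
    lemma x with Q x in eq
    ... | true  rewrite Q⇒P x eq = refl
    ... | false with P x
    ...   | true  = refl
    ...   | false = refl

length-filter-∨ : (P Q : X → Bool) (xs : List X) →
  length (filterᵇ (λ x → P x ∨ Q x) xs) ≤ length (filterᵇ P xs) + length (filterᵇ Q xs)
length-filter-∨ P Q [] = z≤n
length-filter-∨ P Q (x ∷ xs) with P x | Q x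
... | true  | true  = s≤s (≤-trans (length-filter-∨ P Q xs) (≤-trans (n≤1+n _) (≤-reflexive (sym (+-suc _ _)))))
... | true  | false = s≤s (length-filter-∨ P Q xs)
... | false | true  = ≤-trans (s≤s (length-filter-∨ P Q xs)) (≤-reflexive (sym (+-suc _ _)))
... | false | false = length-filter-∨ P Q xs

∈-filter⁺ : (P : X → Bool) {x : X} {xs : List X} → x ∈ xs → P x ≡ true → x ∈ filterᵇ P xs
∈-filter⁺ P x∈ Px = ∈.∈-filter⁺ (T? ∘ P) x∈ (Equivalence.from T-≡ Px)

∈-filter⁻ : (P : X → Bool) {x : X} (xs : List X) → x ∈ filterᵇ P xs → (x ∈ xs) × (P x ≡ true)
∈-filter⁻ P xs x∈ with ∈.∈-filter⁻ (T? ∘ P) x∈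
... | x∈xs , Px = x∈xs , Equivalence.to T-≡ Px

filter-split : (P : X → Bool) (xs : List X) → AllPairs (λ x y → P y ≡ true → P x ≡ true) xs →
               xs ≡ filterᵇ P xs ++ filterᵇ (λ x → not (P x)) xs
filter-split P []       []       = refl
filter-split P (x ∷ xs) (a ∷ ap) = split (P x) refl
  where
    false-of : P x ≡ false → ∀ {y} → (P y ≡ true → P x ≡ true) → P y ≡ false
    false-of eq {y} h with P y
    ... | false = refl
    ... | true with trans (sym eq) (h refl)
    ...   | ()
    split : (b : Bool) → P x ≡ b → x ∷ xs ≡ filterᵇ P (x ∷ xs) ++ filterᵇ (λ x → not (P x)) (x ∷ xs)
    split true eq
      rewrite filter-accept P xs eq | filter-reject (λ x → not (P x)) xs (cong not eq) =
      cong (x ∷_) (filter-split P xs ap)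
    split false eq
      rewrite filter-reject P xs eq | filter-accept (λ x → not (P x)) xs (cong not eq)
            | filter-none P xs (All.map (false-of eq) a)
            | filter-all (λ x → not (P x)) xs (All.map (λ e → cong not (false-of eq e)) a) = refl

filter-split′ : (xs : List X) (Q P R₁ R₂ : X → Bool) →
  AllPairs (λ x y → P y ≡ true → P x ≡ true) (filterᵇ Q xs) →
  (∀ x → (Q x ∧ P x) ≡ R₁ x) → (∀ x → (Q x ∧ not (P x)) ≡ R₂ x) →
  filterᵇ Q xs ≡ filterᵇ R₁ xs ++ filterᵇ R₂ xs
filter-split′ xs Q P R₁ R₂ down e₁ e₂ =
  trans (filter-split P (filterᵇ Q xs) down)
        (cong₂ _++_ (trans (filter-filter Q P xs) (filter-cong _ R₁ xs (All.tabulate λ {x} _ → e₁ x)))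
                    (trans (filter-filter Q (λ x → not (P x)) xs) (filter-cong _ R₂ xs (All.tabulate λ {x} _ → e₂ x))))

AllPairs-restrict : ∀ {P : X → Set} {R S : X → X → Set} {xs : List X} → All P xs → AllPairs R xs →
                    (∀ a b → P a → P b → R a b → S a b) → AllPairs S xs
AllPairs-restrict []         []         f = []
AllPairs-restrict (px ∷ pxs) (rx ∷ rxs) f = pairs pxs rx ∷ AllPairs-restrict pxs rxs f
  where
    pairs : ∀ {ys} → All _ ys → All _ ys → All _ ys
    pairs []         []         = []
    pairs (py ∷ pys) (ry ∷ rys) = f _ _ px py ry ∷ pairs pys rys

Increasing : ∀ {n} → List (Fin n) → Set
Increasing = AllPairs (λ p q → toℕ p < toℕ q)

allFin-increasing : ∀ n → Increasing (allFin n)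
allFin-increasing n = AllPairs.tabulate⁺-< (λ i<j → i<j)

increasing-unique : ∀ {n} (xs ys : List (Fin n)) → Increasing xs → Increasing ys →
  (∀ {z} → z ∈ xs → z ∈ ys) → (∀ {z} → z ∈ ys → z ∈ xs) → xs ≡ ys
increasing-unique []       []       _ _ _ _ = refl
increasing-unique []       (y ∷ ys) _ _ _ h with h (here refl)
... | ()
increasing-unique (x ∷ xs) []       _ _ h _ with h (here refl)
... | ()
increasing-unique (x ∷ xs) (y ∷ ys) (ax ∷ apx) (ay ∷ apy) h₁ h₂ with FinP.<-cmp x y
... | tri< lt _ _ with h₁ (here refl)
...   | here refl = ⊥-elim (<-irrefl refl lt)
...   | there x∈ = ⊥-elim (<-asym lt (All.lookup ay x∈))
increasing-unique (x ∷ xs) (y ∷ ys) (ax ∷ apx) (ay ∷ apy) h₁ h₂ | tri> _ _ gt with h₂ (here refl)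
...   | here refl = ⊥-elim (<-irrefl refl gt)
...   | there y∈ = ⊥-elim (<-asym gt (All.lookup ax y∈))
increasing-unique (x ∷ xs) (y ∷ ys) (ax ∷ apx) (ay ∷ apy) h₁ h₂ | tri≈ _ refl _ =
  cong (x ∷_) (increasing-unique xs ys apx apy tail₁ tail₂)
  where
    tail₁ : ∀ {z} → z ∈ xs → z ∈ ys
    tail₁ z∈ with h₁ (there z∈)
    ... | here refl = ⊥-elim (<-irrefl refl (All.lookup ax z∈))
    ... | there z∈′ = z∈′
    tail₂ : ∀ {z} → z ∈ ys → z ∈ xs
    tail₂ z∈ with h₂ (there z∈)
    ... | here refl = ⊥-elim (<-irrefl refl (All.lookup ay z∈))
    ... | there z∈′ = z∈′

interval : ℕ → ℕ → List ℕ
interval b zero    = []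
interval b (suc l) = b ∷ interval (suc b) l

interval-lower : (f : X → ℕ) {b l : ℕ} (xs : List X) → map f xs ≡ interval b l → All (λ x → b ≤ f x) xs
interval-lower f [] e = []
interval-lower f {b} {suc l} (x ∷ xs) e with ∷-injective e
... | e₁ , e₂ = ≤-reflexive (sym e₁) ∷ All.map (≤-trans (n≤1+n b)) (interval-lower f xs e₂)

interval-sorted : (f : X → ℕ) {b l : ℕ} (xs : List X) → map f xs ≡ interval b l → AllPairs (λ x y → f x < f y) xs
interval-sorted f [] e = []
interval-sorted f {b} {suc l} (x ∷ xs) e with ∷-injective e
... | e₁ , e₂ = All.map (≤-trans (s≤s (≤-reflexive e₁))) (interval-lower f xs e₂) ∷ interval-sorted f xs e₂

interval-upper : ∀ b l {x} → x ∈ interval b l → x < b + l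
interval-upper b (suc l) (here refl) = ≤-trans (s≤s (m≤m+n b l)) (≤-reflexive (sym (+-suc b l)))
interval-upper b (suc l) (there x∈)  = ≤-trans (interval-upper (suc b) l x∈) (≤-reflexive (sym (+-suc b l)))

interval-last : ∀ b l → b + l ∈ interval b (suc l)
interval-last b zero    rewrite +-identityʳ b = here refl
interval-last b (suc l) rewrite +-suc b l = there (interval-last (suc b) l)

interval-split : (f : X → ℕ) (b : ℕ) (xs ys : List X) → map f (xs ++ ys) ≡ interval b (length (xs ++ ys)) →
  (map f xs ≡ interval b (length xs)) × (map f ys ≡ interval (b + length xs) (length ys))
interval-split f b []       ys e rewrite +-identityʳ b = refl , e
interval-split f b (x ∷ xs) ys e with ∷-injective e
... | e₁ , e₂ with interval-split f (suc b) xs ys e₂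
...   | r₁ , r₂ rewrite +-suc b (length xs) = cong₂ _∷_ e₁ r₁ , r₂

tabulate-interval : ∀ {n} (f : Fin n → ℕ) b → (∀ i → f i ≡ b + toℕ i) → tabulate f ≡ interval b n
tabulate-interval {zero}  f b h = refl
tabulate-interval {suc n} f b h = cong₂ _∷_ (trans (h Data.Fin.zero) (+-identityʳ b))
  (tabulate-interval (λ i → f (Data.Fin.suc i)) (suc b) (λ i → trans (h (Data.Fin.suc i)) (+-suc b (toℕ i))))

allFin-interval : ∀ n → map (λ p → suc (toℕ p)) (allFin n) ≡ interval 1 n
allFin-interval n = trans (map-tabulate (λ i → i) (λ p → suc (toℕ p))) (tabulate-interval _ 1 (λ i → refl))

length-interval : ∀ b l → length (interval b l) ≡ l
length-interval b zero    = refl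
length-interval b (suc l) = cong suc (length-interval (suc b) l)

∈-concatMap-intro : ∀ {A B : Set} (f : A → List B) {x y ys} → y ∈ ys → x ∈ f y → x ∈ concatMap f ys
∈-concatMap-intro f y∈ys x∈fy = ∈-concatMap⁺ f (Any.map (λ { refl → x∈fy }) y∈ys)

drop-suc : ∀ {A : Set} j (xs : List A) {b rest} → drop j xs ≡ b ∷ rest → drop (suc j) xs ≡ rest
drop-suc zero    (x ∷ xs) refl = refl
drop-suc (suc j) (x ∷ xs) eq   = drop-suc j xs eq

drop-<-length : ∀ {A : Set} j (xs : List A) {b rest} → drop j xs ≡ b ∷ rest → suc j ≤ length xs
drop-<-length zero    (x ∷ xs) refl = s≤s z≤n
drop-<-length (suc j) (x ∷ xs) eq   = s≤s (drop-<-length j xs eq)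

-- A deterministic sequential machine (Mealy machine writing a word per
-- input letter) whose reachable states all lie in a finite list is
-- realised by a transducer in the sense of Defs: the transducer has a
-- state  idle s  for every listed machine state and states  emitting s a j
-- that write the output word of the step (s, a) one letter at a time.
module SequentialMachine
  {A B S : Set} (_≟A_ : DecidableEquality A) (_≟S_ : DecidableEquality S)
  (alphabet : List A) (∈-alphabet : ∀ a → a ∈ alphabet)
  (start : S) (next : S → A → S) (out : S → A → List B)
  (Good : S → Set) (good-start : Good start) (good-next : ∀ s a → Good (next s a))
  (goodStates : List S) (∈-goodStates : ∀ s → Good s → s ∈ goodStates) where

  output : S → List A → List B
  output s []      = []
  output s (a ∷ w) = out s a ++ output (next s a) w

  data Control : Set where
    idle     : S → Control
    emitting : S → A → ℕ → Control

  _≟C_ : DecidableEquality Control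
  idle s ≟C idle t with s ≟S t
  ... | yes refl = yes refl
  ... | no s≢t   = no λ { refl → s≢t refl }
  idle _ ≟C emitting _ _ _ = no λ ()
  emitting _ _ _ ≟C idle _ = no λ ()
  emitting s a j ≟C emitting t b i with s ≟S t | a ≟A b | j ℕ.≟ i
  ... | yes refl | yes refl | yes refl = yes refl
  ... | no ne | _      | _      = no λ { refl → ne refl }
  ... | yes _ | no ne  | _      = no λ { refl → ne refl }
  ... | yes _ | yes _  | no ne  = no λ { refl → ne refl }

  -- the finitely many control states, as a list; a state is its index
  controls : List Control
  controls = idle start ∷ map idle goodStates ++
    concatMap (λ s → concatMap (λ a → map (emitting s a) (upTo (suc (length (out s a))))) alphabet) goodStates

  Index : Set
  Index = Fin (length controls)

  findIndex : (c : Control) (cs : List Control) → Maybe (Fin (length cs))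
  findIndex c []       = nothing
  findIndex c (c′ ∷ cs) with c ≟C c′
  ... | yes _ = just Data.Fin.zero
  ... | no _ with findIndex c cs
  ...   | just i  = just (Data.Fin.suc i)
  ...   | nothing = nothing

  findIndex-∈ : ∀ c cs → c ∈ cs → Σ (Fin (length cs)) λ i → (findIndex c cs ≡ just i) × (lookup cs i ≡ c)
  findIndex-∈ c (c′ ∷ cs) c∈ with c ≟C c′
  ... | yes refl = Data.Fin.zero , refl , refl
  ... | no c≢c′ with c∈
  ...   | here refl = ⊥-elim (c≢c′ refl)
  ...   | there c∈cs with findIndex c cs | findIndex-∈ c cs c∈cs
  ...     | just i | .i , refl , eq = Data.Fin.suc i , refl , eq

  index : Control → Index
  index c with findIndex c controls
  ... | just i  = i
  ... | nothing = Data.Fin.zero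

  lookup-index : ∀ c → c ∈ controls → lookup controls (index c) ≡ c
  lookup-index c c∈ with findIndex c controls | findIndex-∈ c controls c∈
  ... | just i | .i , refl , eq = eq

  idle∈ : ∀ s → Good s → idle s ∈ controls
  idle∈ s g = there (∈-++⁺ˡ (∈-map⁺ idle (∈-goodStates s g)))

  emitting∈ : ∀ s a j → Good s → j ≤ length (out s a) → emitting s a j ∈ controls
  emitting∈ s a j g j≤ = there (∈-++⁺ʳ (map idle goodStates)
    (∈-concatMap-intro (λ s → concatMap (λ a → map (emitting s a) (upTo (suc (length (out s a))))) alphabet)
      (∈-goodStates s g)
      (∈-concatMap-intro (λ a → map (emitting s a) (upTo (suc (length (out s a))))) (∈-alphabet a)
        (∈-map⁺ (emitting s a) (∈-upTo⁺ (s≤s j≤))))))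

  Transition : Set
  Transition = Index × Maybe A × Maybe B × Index

  -- in emitting s a j, with rest the still unwritten part of out s a
  emitTransitions : Index → S → A → ℕ → List B → List Transition
  emitTransitions i s a j []      = (i , nothing , nothing , index (idle (next s a))) ∷ []
  emitTransitions i s a j (b ∷ _) = (i , nothing , just b , index (emitting s a (suc j))) ∷ []

  transitionsOf : Index → Control → List Transition
  transitionsOf i (idle s)         = map (λ a → (i , just a , nothing , index (emitting s a 0))) alphabet
  transitionsOf i (emitting s a j) = emitTransitions i s a j (drop j (out s a))

  transitionsAt : Index → List Transition
  transitionsAt i = transitionsOf i (lookup controls i)

  IsIdle : Control → Set
  IsIdle (idle _)         = ⊤
  IsIdle (emitting _ _ _) = ⊥

  T : Transducer A B
  T = record { states      = length controls
             ; initial     = index (idle start)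
             ; accepting   = λ i → IsIdle (lookup controls i)
             ; transitions = concatMap transitionsAt (allFin (length controls)) }

  Accepting : Index → Set
  Accepting i = IsIdle (lookup controls i)

  transition-of : ∀ c {t} → c ∈ controls → t ∈ transitionsOf (index c) c → t ∈ Transducer.transitions T
  transition-of c c∈ t∈ = ∈-concatMap-intro transitionsAt (∈-allFin (index c))
    (subst (λ c′ → _ ∈ transitionsOf (index c) c′) (sym (lookup-index c c∈)) t∈)

  emitted-in : ∀ s → Good s → ∀ a j {rest} → drop j (out s a) ≡ rest → j ≤ length (out s a) → ∀ {t} →
               t ∈ emitTransitions (index (emitting s a j)) s a j rest → t ∈ Transducer.transitions T
  emitted-in s g a j eq j≤ t∈ = transition-of (emitting s a j) (emitting∈ s a j g j≤)
    (subst (λ l → _ ∈ emitTransitions (index (emitting s a j)) s a j l) (sym eq) t∈)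

  mutual
    run-idle : ∀ s → Good s → ∀ w → Σ Index λ f → Run T (index (idle s)) w (output s w) f × Accepting f
    run-idle s g []      = index (idle s) , done , subst IsIdle (sym (lookup-index (idle s) (idle∈ s g))) tt
    run-idle s g (a ∷ w) with run-emitting s g a 0 (out s a) refl z≤n w
    ... | f , r , acc = f , step (transition-of (idle s) (idle∈ s g) (∈-map⁺ (λ a → (index (idle s) , just a , nothing , index (emitting s a 0))) (∈-alphabet a))) r , acc

    run-emitting : ∀ s → Good s → ∀ a j rest → drop j (out s a) ≡ rest → j ≤ length (out s a) → ∀ w →
                   Σ Index λ f → Run T (index (emitting s a j)) w (rest ++ output (next s a) w) f × Accepting f
    run-emitting s g a j [] eq j≤ w with run-idle (next s a) (good-next s a) w
    ... | f , r , acc = f , step (emitted-in s g a j eq j≤ (here refl)) r , acc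
    run-emitting s g a j (b ∷ rest) eq j≤ w
      with run-emitting s g a (suc j) rest (drop-suc j (out s a) eq) (drop-<-length j (out s a) eq) w
    ... | f , r , acc = f , step (emitted-in s g a j eq j≤ (here refl)) r , acc

  source-emitTransitions : ∀ i s a j l {t} → t ∈ emitTransitions i s a j l → proj₁ t ≡ i
  source-emitTransitions i s a j []      (here refl) = refl
  source-emitTransitions i s a j (b ∷ l) (here refl) = refl

  source-transitionsOf : ∀ i c {t} → t ∈ transitionsOf i c → proj₁ t ≡ i
  source-transitionsOf i (idle s) t∈ with ∈-map⁻ (λ a → (i , just a , nothing , index (emitting s a 0))) t∈
  ... | a , _ , refl = refl
  source-transitionsOf i (emitting s a j) t∈ = source-emitTransitions i s a j (drop j (out s a)) t∈

  transition-at : ∀ {i x y i′} → (i , x , y , i′) ∈ Transducer.transitions T → (i , x , y , i′) ∈ transitionsAt i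
  transition-at t∈ with satisfied (∈-concatMap⁻ transitionsAt {xs = allFin (length controls)} t∈)
  ... | i , t∈i with source-transitionsOf i (lookup controls i) t∈i
  ...   | refl = t∈i

  transition-from : ∀ c → c ∈ controls → ∀ {x y i′} →
                    (index c , x , y , i′) ∈ Transducer.transitions T → (index c , x , y , i′) ∈ transitionsOf (index c) c
  transition-from c c∈ {x} {y} {i′} t∈ = subst (λ c′ → (index c , x , y , i′) ∈ transitionsOf (index c) c′) (lookup-index c c∈) (transition-at t∈)

  emitted-from : ∀ s → Good s → ∀ a j {rest} → drop j (out s a) ≡ rest → j ≤ length (out s a) → ∀ {x y i′} →
                 (index (emitting s a j) , x , y , i′) ∈ Transducer.transitions T →
                 (index (emitting s a j) , x , y , i′) ∈ emitTransitions (index (emitting s a j)) s a j rest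
  emitted-from s g a j eq j≤ {x} {y} {i′} t∈ =
    subst (λ l → (index (emitting s a j) , x , y , i′) ∈ emitTransitions (index (emitting s a j)) s a j l) eq (transition-from (emitting s a j) (emitting∈ s a j g j≤) t∈)

  emit-last : ∀ {i s a j x y i′} → (i , x , y , i′) ∈ emitTransitions i s a j [] →
              (x ≡ nothing) × (y ≡ nothing) × (i′ ≡ index (idle (next s a)))
  emit-last (here refl) = refl , refl , refl

  emit-next : ∀ {i s a j b l x y i′} → (i , x , y , i′) ∈ emitTransitions i s a j (b ∷ l) →
              (x ≡ nothing) × (y ≡ just b) × (i′ ≡ index (emitting s a (suc j)))
  emit-next (here refl) = refl , refl , refl

  mutual
    output-idle : ∀ s → Good s → ∀ {w o f} → Run T (index (idle s)) w o f → Accepting f → o ≡ output s w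
    output-idle s g done acc = refl
    output-idle s g (step t∈ r) acc
      with ∈-map⁻ (λ a → (index (idle s) , just a , nothing , index (emitting s a 0))) (transition-from (idle s) (idle∈ s g) t∈)
    ... | a , _ , refl = output-emitting s g a 0 (out s a) refl z≤n r acc

    output-emitting : ∀ s → Good s → ∀ a j rest → drop j (out s a) ≡ rest → j ≤ length (out s a) →
                      ∀ {w o f} → Run T (index (emitting s a j)) w o f → Accepting f →
                      o ≡ rest ++ output (next s a) w
    output-emitting s g a j rest eq j≤ done acc =
      ⊥-elim (subst IsIdle (lookup-index (emitting s a j) (emitting∈ s a j g j≤)) acc)
    output-emitting s g a j [] eq j≤ (step t∈ r) acc
      with emit-last {s = s} {a} {j} (emitted-from s g a j eq j≤ t∈)
    ... | refl , refl , refl = output-idle (next s a) (good-next s a) r acc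
    output-emitting s g a j (b ∷ rest) eq j≤ (step t∈ r) acc
      with emit-next {s = s} {a} {j} {b} {rest} (emitted-from s g a j eq j≤ t∈)
    ... | refl , refl , refl = cong (b ∷_)
      (output-emitting s g a (suc j) rest (drop-suc j (out s a) eq) (drop-<-length j (out s a) eq) r acc)

  realises : ∀ w → Outputs T w (output start w) × (∀ o → Outputs T w o → o ≡ output start w)
  realises w = run-idle start good-start w , λ { o (f , r , acc) → output-idle start good-start r acc }

runMax : ℕ → List ℕ → ℕ
runMax m []       = m
runMax m (x ∷ xs) = runMax (m ⊔ x) xs

walk : ℕ → List ℕ → List UD
walk m []       = []
walk m (x ∷ xs) = replicate (x ∸ m) u ++ d ∷ walk (m ⊔ x) xs

runMax-++ : ∀ m xs ys → runMax m (xs ++ ys) ≡ runMax (runMax m xs) ys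
runMax-++ m []       ys = refl
runMax-++ m (x ∷ xs) ys = runMax-++ (m ⊔ x) xs ys

walk-++ : ∀ m xs ys → walk m (xs ++ ys) ≡ walk m xs ++ walk (runMax m xs) ys
walk-++ m []       ys = refl
walk-++ m (x ∷ xs) ys =
  trans (cong (λ w → replicate (x ∸ m) u ++ d ∷ w) (walk-++ (m ⊔ x) xs ys))
        (sym (++-assoc (replicate (x ∸ m) u) (d ∷ walk (m ⊔ x) xs) _))

walk-shift : ∀ q m xs → walk (q + m) (map (q +_) xs) ≡ walk m xs
walk-shift q m []       = refl
walk-shift q m (x ∷ xs) rewrite [m+n]∸[m+o]≡n∸o q x m | sym (+-distribˡ-⊔ q m x) =
  cong (λ w → replicate (x ∸ m) u ++ d ∷ w) (walk-shift q (m ⊔ x) xs)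

runMax-shift : ∀ q m xs → runMax (q + m) (map (q +_) xs) ≡ q + runMax m xs
runMax-shift q m []       = refl
runMax-shift q m (x ∷ xs) rewrite sym (+-distribˡ-⊔ q m x) = runMax-shift q (m ⊔ x) xs

runMax-≥ : ∀ m xs → m ≤ runMax m xs
runMax-≥ m []       = ≤-refl
runMax-≥ m (x ∷ xs) = ≤-trans (m≤m⊔n m x) (runMax-≥ (m ⊔ x) xs)

runMax-∈ : ∀ m {x} xs → x ∈ xs → x ≤ runMax m xs
runMax-∈ m (y ∷ xs) (here refl) = ≤-trans (m≤n⊔m m y) (runMax-≥ (m ⊔ y) xs)
runMax-∈ m (y ∷ xs) (there x∈)  = runMax-∈ (m ⊔ y) xs x∈

runMax-lub : ∀ m xs {B} → m ≤ B → All (_≤ B) xs → runMax m xs ≤ B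
runMax-lub m []       m≤B []         = m≤B
runMax-lub m (x ∷ xs) m≤B (x≤B ∷ xs≤B) = runMax-lub (m ⊔ x) xs (⊔-lub m≤B x≤B) xs≤B

allᵇ-++ : ∀ {A : Set} (P : A → Bool) xs ys → allᵇ P (xs ++ ys) ≡ allᵇ P xs ∧ allᵇ P ys
allᵇ-++ P []       ys = refl
allᵇ-++ P (x ∷ xs) ys rewrite allᵇ-++ P xs ys = sym (∧-assoc (P x) (allᵇ P xs) (allᵇ P ys))

allᵇ-cong : ∀ {A : Set} (P Q : A → Bool) xs → All (λ x → P x ≡ Q x) xs → allᵇ P xs ≡ allᵇ Q xs
allᵇ-cong P Q []       []      = refl
allᵇ-cong P Q (x ∷ xs) (e ∷ a) = cong₂ _∧_ e (allᵇ-cong P Q xs a)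

allᵇ-true : ∀ {A : Set} (P : A → Bool) xs → All (λ x → P x ≡ true) xs → allᵇ P xs ≡ true
allᵇ-true P []       []      = refl
allᵇ-true P (x ∷ xs) (e ∷ a) rewrite e = allᵇ-true P xs a

allᵇ-map : ∀ {A : Set} (P : ℕ → Bool) (f : A → ℕ) xs → allᵇ (λ q → P (f q)) xs ≡ allᵇ P (map f xs)
allᵇ-map P f []       = refl
allᵇ-map P f (x ∷ xs) = cong (P (f x) ∧_) (allᵇ-map P f xs)

⊔-<ᵇ : ∀ m x y → (m ⊔ x <ᵇ y) ≡ (m <ᵇ y) ∧ (x <ᵇ y)
⊔-<ᵇ zero    x       zero    = refl
⊔-<ᵇ zero    x       (suc y) = refl
⊔-<ᵇ (suc m) zero    zero    = refl
⊔-<ᵇ (suc m) zero    (suc y) with m <ᵇ y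
... | true  = refl
... | false = refl
⊔-<ᵇ (suc m) (suc x) zero    = refl
⊔-<ᵇ (suc m) (suc x) (suc y) = ⊔-<ᵇ m x y

runMax-<ᵇ : ∀ m xs y → allᵇ (_<ᵇ y) xs ∧ (m <ᵇ y) ≡ (runMax m xs <ᵇ y)
runMax-<ᵇ m []       y = refl
runMax-<ᵇ m (x ∷ xs) y rewrite sym (runMax-<ᵇ (m ⊔ x) xs y) | ⊔-<ᵇ m x y =
  trans (∧-assoc (x <ᵇ y) (allᵇ (_<ᵇ y) xs) (m <ᵇ y))
   (trans (cong ((x <ᵇ y) ∧_) (∧-comm (allᵇ (_<ᵇ y) xs) (m <ᵇ y)))
     (trans (sym (∧-assoc (x <ᵇ y) (m <ᵇ y) _))
       (trans (cong (_∧ allᵇ (_<ᵇ y) xs) (∧-comm (x <ᵇ y) (m <ᵇ y)))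
         (∧-comm _ (allᵇ (_<ᵇ y) xs)))))

records : ℕ → List (ℕ × ℕ) → List (ℕ × ℕ)
records m []             = []
records m ((i , x) ∷ ps) = if m <ᵇ x then (i , x) ∷ records (m ⊔ x) ps else records (m ⊔ x) ps

records-All : ∀ {P : ℕ × ℕ → Set} m ps → All P ps → All P (records m ps)
records-All m []             []      = []
records-All m ((i , x) ∷ ps) (p ∷ a) with m <ᵇ x
... | true  = p ∷ records-All (m ⊔ x) ps a
... | false = records-All (m ⊔ x) ps a

records-AllPairs : ∀ {R : ℕ × ℕ → ℕ × ℕ → Set} m ps → AllPairs R ps → AllPairs R (records m ps)
records-AllPairs m []             []       = []
records-AllPairs m ((i , x) ∷ ps) (a ∷ ap) with m <ᵇ x
... | true  = records-All (m ⊔ x) ps a ∷ records-AllPairs (m ⊔ x) ps ap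
... | false = records-AllPairs (m ⊔ x) ps ap

∸-suc : ∀ i s → s < i → i ∸ s ≡ suc (i ∸ suc s)
∸-suc (suc i) s (s≤s s≤i) = +-∸-assoc 1 s≤i

module DyckFrom (N : ℕ) where

  dyckFrom : ℕ → ℕ → List (ℕ × ℕ) → List UD
  dyckFrom s m []            = replicate (suc N ∸ s) d
  dyckFrom s m ((i , v) ∷ L) = replicate (i ∸ s) d ++ replicate (v ∸ m) u ++ d ∷ dyckFrom (suc i) v L

  StartsAfter : ℕ → List (ℕ × ℕ) → Set
  StartsAfter s []            = ⊤
  StartsAfter s ((i , v) ∷ L) = s ≤ i

  dyckFrom-step : ∀ s m L → s < suc N → StartsAfter (suc s) L → dyckFrom s m L ≡ d ∷ dyckFrom (suc s) m L
  dyckFrom-step s m []            (s≤s s≤N) _   rewrite +-∸-assoc 1 s≤N = refl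
  dyckFrom-step s m ((i , v) ∷ L) _         s<i rewrite ∸-suc i s s<i = refl

  walk≡dyckFrom : ∀ s m (ps : List (ℕ × ℕ)) → map proj₁ ps ≡ interval s (length ps) → s + length ps ≡ suc N →
                  walk m (map proj₂ ps) ≡ dyckFrom s m (records m ps)
  walk≡dyckFrom s m [] _ s≡ rewrite sym s≡ | +-identityʳ s | n∸n≡0 s = refl
  walk≡dyckFrom s m ((i , x) ∷ ps) positions end with ∷-injective positions
  ... | refl , positions′ with m <ᵇ x in m<x
  ...   | true rewrite m≤n⇒m⊔n≡n (<⇒≤ (<ᵇ-true⁻ m x m<x)) | n∸n≡0 i =
    cong (λ w → replicate (x ∸ m) u ++ d ∷ w) (walk≡dyckFrom (suc i) x ps positions′ end′)
    where end′ = trans (sym (+-suc i (length ps))) end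
  ...   | false rewrite m≥n⇒m⊔n≡m (<ᵇ-false⁻ m x m<x) | m≤n⇒m∸n≡0 (<ᵇ-false⁻ m x m<x) =
    trans (cong (d ∷_) (walk≡dyckFrom (suc i) m ps positions′ end′))
          (sym (dyckFrom-step i m (records m ps) i<N+1 later))
    where
      end′ = trans (sym (+-suc i (length ps))) end
      i<N+1 : i < suc N
      i<N+1 = ≤-trans (s≤s (m≤m+n i (length ps))) (≤-reflexive (trans (sym (+-suc i (length ps))) end))
      later : StartsAfter (suc i) (records m ps)
      later with records m ps | records-All m ps (interval-lower proj₁ ps positions′)
      ... | []          | _       = _
      ... | (j , w) ∷ _ | i<j ∷ _ = i<j

  dyckWord≡dyckFrom : ∀ prev i v L → All (λ e → i < proj₁ e) L → AllPairs (λ a b → proj₁ a < proj₁ b) L →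
                      All (λ e → proj₁ e ≤ N) ((i , v) ∷ L) →
                      dyckWord N prev ((i , v) ∷ L) ≡ replicate (v ∸ prev) u ++ d ∷ dyckFrom (suc i) v L
  dyckWord≡dyckFrom prev i v [] _ _ (i≤N ∷ _) rewrite +-∸-assoc 1 i≤N = refl
  dyckWord≡dyckFrom prev i v ((i′ , v′) ∷ L) (i<i′ ∷ a) (a′ ∷ ap) (_ ∷ bounds) =
    cong (replicate (v ∸ prev) u ++_)
      (trans (cong (replicate (i′ ∸ i) d ++_) (dyckWord≡dyckFrom v i′ v′ L a′ ap bounds))
             (cong (_++ _) (cong (λ k → replicate k d) (∸-suc i′ i i<i′))))

dyckWord-records : ∀ N (ps : List (ℕ × ℕ)) → map proj₁ ps ≡ interval 1 N → length ps ≡ N →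
                   All (λ e → 1 ≤ proj₂ e) ps → dyckWord N 0 (records 0 ps) ≡ walk 0 (map proj₂ ps)
dyckWord-records N [] positions refl a = refl
dyckWord-records N ((i , x) ∷ ps) positions refl (s≤s z≤n ∷ a) with ∷-injective positions
... | refl , positions′ =
  trans (dyckWord≡dyckFrom 0 1 x (records x ps) (proj₁ later) (proj₂ later) bounds)
        (sym (walk≡dyckFrom 1 0 ((1 , x) ∷ ps) positions refl))
  where
    open DyckFrom N
    sorted : AllPairs (λ a c → proj₁ a < proj₁ c) (records 0 ((1 , x) ∷ ps))
    sorted = records-AllPairs 0 ((1 , x) ∷ ps) (interval-sorted proj₁ ((1 , x) ∷ ps) positions)
    later : All (λ e → 1 < proj₁ e) (records x ps) × AllPairs (λ a c → proj₁ a < proj₁ c) (records x ps)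
    later with sorted
    ... | h ∷ t = h , t
    bounds : All (λ e → proj₁ e ≤ N) (records 0 ((1 , x) ∷ ps))
    bounds = records-All 0 ((1 , x) ∷ ps) (All.tabulate {xs = (1 , x) ∷ ps} λ {e} e∈ →
      ≤-pred (interval-upper 1 N (subst (proj₁ e ∈_) positions (∈-map⁺ proj₁ e∈))))

AllPairs-++⁻ : ∀ {A : Set} {R : A → A → Set} (xs ys : List A) → AllPairs R (xs ++ ys) →
               AllPairs R xs × AllPairs R ys × All (λ x → All (R x) ys) xs
AllPairs-++⁻ []       ys ap       = [] , ap , []
AllPairs-++⁻ (x ∷ xs) ys (a ∷ ap) with AllPairs-++⁻ xs ys ap
... | p₁ , p₂ , p₃ = All.++⁻ˡ xs a ∷ p₁ , p₂ , All.++⁻ʳ xs a ∷ p₃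

module DyckOfValues (n : ℕ) (σ : Fin n → Fin n) where

  value : Fin n → ℕ
  value p = suc (toℕ (σ p))

  entry : Fin n → ℕ × ℕ
  entry p = (suc (toℕ p) , value p)

  isLTRMax-runMax : ∀ pre p post → pre ++ p ∷ post ≡ allFin n →
                    isLTRMax n σ p ≡ (runMax 0 (map value pre) <ᵇ value p)
  isLTRMax-runMax pre p post split = begin
      allᵇ earlierBelow (allFin n)
        ≡⟨ cong (allᵇ earlierBelow) (sym split) ⟩
      allᵇ earlierBelow (pre ++ p ∷ post)
        ≡⟨ allᵇ-++ earlierBelow pre (p ∷ post) ⟩
      allᵇ earlierBelow pre ∧ (earlierBelow p ∧ allᵇ earlierBelow post)
        ≡⟨ cong₂ (λ a b → a ∧ (b ∧ allᵇ earlierBelow post)) on-pre on-p ⟩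
      allᵇ (λ q → value q <ᵇ value p) pre ∧ (true ∧ allᵇ earlierBelow post)
        ≡⟨ cong (allᵇ (λ q → value q <ᵇ value p) pre ∧_) on-post ⟩
      allᵇ (λ q → value q <ᵇ value p) pre ∧ true
        ≡⟨ cong (_∧ true) (allᵇ-map (_<ᵇ value p) value pre) ⟩
      allᵇ (_<ᵇ value p) (map value pre) ∧ true
        ≡⟨ runMax-<ᵇ 0 (map value pre) (value p) ⟩
      (runMax 0 (map value pre) <ᵇ value p) ∎
    where
      open ≡-Reasoning
      earlierBelow : Fin n → Bool
      earlierBelow q = not (toℕ q <ᵇ toℕ p) ∨ (toℕ (σ q) <ᵇ toℕ (σ p))
      parts = AllPairs-++⁻ pre (p ∷ post) (subst Increasing (sym split) (allFin-increasing n))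
      on-pre : allᵇ earlierBelow pre ≡ allᵇ (λ q → value q <ᵇ value p) pre
      on-pre = allᵇ-cong earlierBelow _ pre (All.map before (proj₂ (proj₂ parts)))
        where
          before : ∀ {q} → All (λ y → toℕ q < toℕ y) (p ∷ post) → earlierBelow q ≡ (value q <ᵇ value p)
          before (q<p ∷ _) rewrite <ᵇ-true q<p = refl
      on-p : earlierBelow p ≡ true
      on-p rewrite <ᵇ-false (≤-refl {toℕ p}) = refl
      on-post : true ∧ allᵇ earlierBelow post ≡ true
      on-post with proj₁ (proj₂ parts)
      ... | p<post ∷ _ = allᵇ-true earlierBelow post (All.map after p<post)
        where
          after : ∀ {q} → toℕ p < toℕ q → earlierBelow q ≡ true
          after p<q rewrite <ᵇ-false (<⇒≤ p<q) = refl

  mutual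
    ltrMaxima-records : ∀ pre post → pre ++ post ≡ allFin n →
      map entry (filterᵇ (isLTRMax n σ) post) ≡ records (runMax 0 (map value pre)) (map entry post)
    ltrMaxima-records pre []         split = refl
    ltrMaxima-records pre (p ∷ post) split rewrite isLTRMax-runMax pre p post split
      with runMax 0 (map value pre) <ᵇ value p
    ... | true  = cong (entry p ∷_) (ltrMaxima-after pre p post split)
    ... | false = ltrMaxima-after pre p post split

    ltrMaxima-after : ∀ pre p post → pre ++ p ∷ post ≡ allFin n →
      map entry (filterᵇ (isLTRMax n σ) post) ≡ records (runMax 0 (map value pre) ⊔ value p) (map entry post)
    ltrMaxima-after pre p post split
      rewrite sym (runMax-++ 0 (map value pre) (value p ∷ [])) | sym (map-++ value pre (p ∷ [])) =
      ltrMaxima-records (pre ++ p ∷ []) post (trans (++-assoc pre (p ∷ []) post) split)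

  dyckEncoding-walk : dyckEncoding n σ ≡ walk 0 (map value (allFin n))
  dyckEncoding-walk =
    trans (cong (dyckWord n 0) (ltrMaxima-records [] (allFin n) refl))
          (trans (dyckWord-records n entries positions entries-length (All.tabulate λ {e} e∈ → values-positive e∈))
                 (cong (walk 0) (sym (map-∘ (allFin n)))))
    where
      entries = map entry (allFin n)
      positions : map proj₁ entries ≡ interval 1 n
      positions = trans (sym (map-∘ (allFin n))) (allFin-interval n)
      entries-length : length entries ≡ n
      entries-length = trans (length-map entry (allFin n)) (length-tabulate (λ i → i))
      values-positive : ∀ {e} → e ∈ entries → 1 ≤ proj₂ e
      values-positive e∈ with ∈-map⁻ entry e∈
      ... | p , _ , refl = s≤s z≤n

-- Letters of domino words: ○ is "white" (the lower-labelled cell of a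
-- domino), ● is "black" (the higher-labelled cell).

_≟DSym_ : DecidableEquality DSym
○ ≟DSym ○ = yes refl
○ ≟DSym ● = no λ ()
○ ≟DSym ♯ = no λ ()
● ≟DSym ○ = no λ ()
● ≟DSym ● = yes refl
● ≟DSym ♯ = no λ ()
♯ ≟DSym ○ = no λ ()
♯ ≟DSym ● = no λ ()
♯ ≟DSym ♯ = yes refl

dsyms : List DSym
dsyms = ○ ∷ ● ∷ ♯ ∷ []

∈-dsyms : ∀ a → a ∈ dsyms
∈-dsyms ○ = here refl
∈-dsyms ● = there (here refl)
∈-dsyms ♯ = there (there (here refl))

isBlack isWhite : DSym → Bool
isBlack ● = true
isBlack _ = false
isWhite ○ = true
isWhite _ = false

nthIndex : ∀ {X : Set} → (X → Bool) → List X → ℕ → ℕ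
nthIndex P []       j       = 0
nthIndex P (x ∷ xs) j with P x | j
... | true  | zero   = 0
... | true  | suc j′ = suc (nthIndex P xs j′)
... | false | j′     = suc (nthIndex P xs j′)

interleave : (ℕ → ℕ) → (ℕ → ℕ) → List DSym → List ℕ
interleave W B []      = []
interleave W B (○ ∷ E) = W 0 ∷ interleave (λ j → W (suc j)) B E
interleave W B (● ∷ E) = B 0 ∷ interleave W (λ j → B (suc j)) E
interleave W B (♯ ∷ E) = interleave W B E

whitePrefix afterWhitePrefix : List DSym → List DSym
whitePrefix (○ ∷ E) = ○ ∷ whitePrefix E
whitePrefix _       = []
afterWhitePrefix (○ ∷ E) = afterWhitePrefix E
afterWhitePrefix E       = E

-- Relative values in block i (cells 2i, 2i+1), given D = d_{2i-1} and
-- C = d_{2i+1}: the j-th entry of cell 2i is the j-th black letter of D,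
-- the j-th entry of cell 2i+1 is the j-th white letter of C.
lowerValue : List DSym → ℕ → ℕ
lowerValue D j = suc (nthIndex isBlack D j)

upperValue : List DSym → List DSym → ℕ → ℕ
upperValue D C j = suc (length D + nthIndex isWhite C j)

-- values of the white prefix of E = d_{2i}: known before d_{2i+1} is read
prefixValues : List DSym → List DSym → List ℕ
prefixValues D E = interleave (lowerValue D) (λ _ → 0) (whitePrefix E)

-- values of the rest of E, which need C = d_{2i+1}
restValues : List DSym → List DSym → List DSym → List ℕ
restValues D E C = interleave (λ j → lowerValue D (length (whitePrefix E) + j)) (upperValue D C) (afterWhitePrefix E)

interleave-split : ∀ W B B₀ E →
  interleave W B E ≡ interleave W B₀ (whitePrefix E) ++ interleave (λ j → W (length (whitePrefix E) + j)) B (afterWhitePrefix E)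
interleave-split W B B₀ []      = refl
interleave-split W B B₀ (○ ∷ E) = cong (W 0 ∷_) (interleave-split (λ j → W (suc j)) B B₀ E)
interleave-split W B B₀ (● ∷ E) = refl
interleave-split W B B₀ (♯ ∷ E) = refl

-- In phase even it stores D = d_{2i-1} and reads
-- E = d_{2i}; in phase odd it reads C = d_{2i+1}.  The number r is the
-- height of the walk so far relative to the values below block i.
data Phase : Set where
  even odd : Phase

data State : Set where
  state : Phase → List DSym → List DSym → List DSym → ℕ → State

advance : State → DSym → State × List UD
advance (state even D E C r) ♯ = state odd D E C r , walk r (prefixValues D E)
advance (state even D E C r) a = state even D (E ++ [ a ]) C r , []
advance (state odd D E C r) ♯ =
  state even C [] [] (runMax (runMax r (prefixValues D E)) (restValues D E C) ∸ length D) ,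
  walk (runMax r (prefixValues D E)) (restValues D E C)
advance (state odd D E C r) a = state odd D E (C ++ [ a ]) r , []

advance-even-letter : ∀ D E C r a → a ≢ ♯ → advance (state even D E C r) a ≡ (state even D (E ++ [ a ]) C r , [])
advance-even-letter D E C r ○ _   = refl
advance-even-letter D E C r ● _   = refl
advance-even-letter D E C r ♯ a≢♯ = ⊥-elim (a≢♯ refl)

advance-odd-letter : ∀ D E C r a → a ≢ ♯ → advance (state odd D E C r) a ≡ (state odd D E (C ++ [ a ]) r , [])
advance-odd-letter D E C r ○ _   = refl
advance-odd-letter D E C r ● _   = refl
advance-odd-letter D E C r ♯ a≢♯ = ⊥-elim (a≢♯ refl)

initialState : State
initialState = state even [] [] [] 0

_≟Phase_ : DecidableEquality Phase
even ≟Phase even = yes refl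
even ≟Phase odd  = no λ ()
odd  ≟Phase even = no λ ()
odd  ≟Phase odd  = yes refl

_≟State_ : DecidableEquality State
state p D E C r ≟State state p′ D′ E′ C′ r′
  with p ≟Phase p′ | ≡-dec _≟DSym_ D D′ | ≡-dec _≟DSym_ E E′ | ≡-dec _≟DSym_ C C′ | r ℕ.≟ r′
... | yes refl | yes refl | yes refl | yes refl | yes refl = yes refl
... | no ne | _      | _      | _      | _      = no λ { refl → ne refl }
... | yes _ | no ne  | _      | _      | _      = no λ { refl → ne refl }
... | yes _ | yes _  | no ne  | _      | _      = no λ { refl → ne refl }
... | yes _ | yes _  | yes _  | no ne  | _      = no λ { refl → ne refl }
... | yes _ | yes _  | yes _  | yes _  | no ne  = no λ { refl → ne refl }

wordsUpTo : ℕ → List (List DSym)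
wordsUpTo zero    = [] ∷ []
wordsUpTo (suc L) = [] ∷ concatMap (λ a → map (a ∷_) (wordsUpTo L)) dsyms

∈-wordsUpTo : ∀ L (xs : List DSym) → length xs ≤ L → xs ∈ wordsUpTo L
∈-wordsUpTo zero    []       _         = here refl
∈-wordsUpTo (suc L) []       _         = here refl
∈-wordsUpTo (suc L) (a ∷ xs) (s≤s xs≤) =
  there (∈-concatMap-intro (λ a → map (a ∷_) (wordsUpTo L)) (∈-dsyms a) (∈-map⁺ (a ∷_) (∈-wordsUpTo L xs xs≤)))

NoSharp : List DSym → Set
NoSharp = All (λ a → a ≢ ♯)

-- When every cell
-- has at most k entries, dominoes have length ≤ 2k and the cut-off with
-- L = 2k never acts; then the machine has finitely many states.
module Bounded (L : ℕ) where

  truncate : State → State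
  truncate (state p D E C r) = state p (take L D) (take L E) (take L C) (r ⊓ L)

  next : State → DSym → State
  next s a = truncate (proj₁ (advance s a))

  out : State → DSym → List UD
  out s a = proj₂ (advance s a)

  Fits : State → Set
  Fits (state p D E C r) = (length D ≤ L) × (length E ≤ L) × (length C ≤ L) × (r ≤ L)

  take-fits : (xs : List DSym) → length (take L xs) ≤ L
  take-fits xs rewrite length-take L xs = m⊓n≤m L (length xs)

  fits-truncate : ∀ s → Fits (truncate s)
  fits-truncate (state p D E C r) = take-fits D , take-fits E , take-fits C , m⊓n≤n r L

  truncate-fits : ∀ s → Fits s → truncate s ≡ s
  truncate-fits (state p D E C r) (D≤ , E≤ , C≤ , r≤)
    rewrite take-all L D D≤ | take-all L E E≤ | take-all L C C≤ | m≤n⇒m⊓n≡m r≤ = refl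

  fittingR : Phase → List DSym → List DSym → List DSym → List State
  fittingR p D E C = map (state p D E C) (upTo (suc L))

  fittingC : Phase → List DSym → List DSym → List State
  fittingC p D E = concatMap (fittingR p D E) (wordsUpTo L)

  fittingE : Phase → List DSym → List State
  fittingE p D = concatMap (fittingC p D) (wordsUpTo L)

  fittingD : Phase → List State
  fittingD p = concatMap (fittingE p) (wordsUpTo L)

  fittingStates : List State
  fittingStates = concatMap fittingD (even ∷ odd ∷ [])

  ∈-fittingStates : ∀ s → Fits s → s ∈ fittingStates
  ∈-fittingStates (state p D E C r) (D≤ , E≤ , C≤ , r≤) =
    ∈-concatMap-intro fittingD (phase∈ p) (∈-concatMap-intro (fittingE p) (∈-wordsUpTo L D D≤)
      (∈-concatMap-intro (fittingC p D) (∈-wordsUpTo L E E≤)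
        (∈-concatMap-intro (fittingR p D E) (∈-wordsUpTo L C C≤) (∈-map⁺ (state p D E C) (∈-upTo⁺ (s≤s r≤))))))
    where
      phase∈ : ∀ p → p ∈ even ∷ odd ∷ []
      phase∈ even = here refl
      phase∈ odd  = there (here refl)

  open SequentialMachine _≟DSym_ _≟State_ dsyms ∈-dsyms initialState next out
    Fits (z≤n , z≤n , z≤n , z≤n) (λ s a → fits-truncate (proj₁ (advance s a)))
    fittingStates ∈-fittingStates public

  finalState : State → List DSym → State
  finalState s []      = s
  finalState s (a ∷ w) = finalState (next s a) w

  output-++ : ∀ s xs ys → output s (xs ++ ys) ≡ output s xs ++ output (finalState s xs) ys
  output-++ s []       ys = refl
  output-++ s (a ∷ xs) ys = trans (cong (out s a ++_) (output-++ (next s a) xs ys)) (sym (++-assoc (out s a) _ _))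

  finalState-++ : ∀ s xs ys → finalState s (xs ++ ys) ≡ finalState (finalState s xs) ys
  finalState-++ s []       ys = refl
  finalState-++ s (a ∷ xs) ys = finalState-++ (next s a) xs ys

  length-++-prefix : ∀ (E : List DSym) a xs → length (E ++ a ∷ xs) ≤ L → length (E ++ [ a ]) ≤ L
  length-++-prefix E a xs E+≤ = ≤-trans (≤-reflexive (length-++ E))
    (≤-trans (+-monoʳ-≤ (length E) (s≤s z≤n)) (≤-trans (≤-reflexive (sym (length-++ E))) E+≤))

  read-even : ∀ D E C r xs → NoSharp xs → Fits (state even D (E ++ xs) C r) →
              (output (state even D E C r) xs ≡ []) × (finalState (state even D E C r) xs ≡ state even D (E ++ xs) C r)
  read-even D E C r [] _ _ rewrite ++-identityʳ E = refl , refl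
  read-even D E C r (a ∷ xs) (a≢♯ ∷ no♯) (D≤ , E≤ , C≤ , r≤)
    rewrite advance-even-letter D E C r a a≢♯ | truncate-fits (state even D (E ++ [ a ]) C r) (D≤ , length-++-prefix E a xs E≤ , C≤ , r≤)
    with read-even D (E ++ [ a ]) C r xs no♯ (D≤ , subst (λ F → length F ≤ L) (sym (++-assoc E [ a ] xs)) E≤ , C≤ , r≤)
  ... | o , s rewrite ++-assoc E [ a ] xs = o , s

  read-odd : ∀ D E C r xs → NoSharp xs → Fits (state odd D E (C ++ xs) r) →
             (output (state odd D E C r) xs ≡ []) × (finalState (state odd D E C r) xs ≡ state odd D E (C ++ xs) r)
  read-odd D E C r [] _ _ rewrite ++-identityʳ C = refl , refl
  read-odd D E C r (a ∷ xs) (a≢♯ ∷ no♯) (D≤ , E≤ , C≤ , r≤)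
    rewrite advance-odd-letter D E C r a a≢♯ | truncate-fits (state odd D E (C ++ [ a ]) r) (D≤ , E≤ , length-++-prefix C a xs C≤ , r≤)
    with read-odd D E (C ++ [ a ]) r xs no♯ (D≤ , E≤ , subst (λ F → length F ≤ L) (sym (++-assoc C [ a ] xs)) C≤ , r≤)
  ... | o , s rewrite ++-assoc C [ a ] xs = o , s

  read-even-domino : ∀ D E r → NoSharp E → Fits (state even D E [] r) →
    (output (state even D [] [] r) (E ++ ♯ ∷ []) ≡ walk r (prefixValues D E)) ×
    (finalState (state even D [] [] r) (E ++ ♯ ∷ []) ≡ state odd D E [] r)
  read-even-domino D E r no♯ fits@(D≤ , E≤ , _ , r≤) with read-even D [] [] r E no♯ fits
  ... | silent , reached =
    trans (output-++ (state even D [] [] r) E (♯ ∷ []))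
          (trans (cong₂ (λ o s → o ++ output s (♯ ∷ [])) silent reached) (++-identityʳ _)) ,
    trans (finalState-++ (state even D [] [] r) E (♯ ∷ []))
          (trans (cong (λ s → finalState s (♯ ∷ [])) reached)
                 (truncate-fits (state odd D E [] r) (D≤ , E≤ , z≤n , r≤)))

  read-odd-domino : ∀ D E C r → NoSharp C → Fits (state odd D E C r) →
    let m = runMax r (prefixValues D E) in runMax m (restValues D E C) ∸ length D ≤ L →
    (output (state odd D E [] r) (C ++ ♯ ∷ []) ≡ walk m (restValues D E C)) ×
    (finalState (state odd D E [] r) (C ++ ♯ ∷ []) ≡ state even C [] [] (runMax m (restValues D E C) ∸ length D))
  read-odd-domino D E C r no♯ fits@(_ , _ , C≤ , _) r′≤ with read-odd D E [] r C no♯ fits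
  ... | silent , reached =
    trans (output-++ (state odd D E [] r) C (♯ ∷ []))
          (trans (cong₂ (λ o s → o ++ output s (♯ ∷ [])) silent reached) (++-identityʳ _)) ,
    trans (finalState-++ (state odd D E [] r) C (♯ ∷ []))
          (trans (cong (λ s → finalState s (♯ ∷ [])) reached)
                 (truncate-fits (state even C [] [] _) (C≤ , z≤n , z≤n , r′≤)))

applyUpTo-cong : ∀ (f h : ℕ → ℕ) l → (∀ j → f j ≡ h j) → applyUpTo f l ≡ applyUpTo h l
applyUpTo-cong f h zero    e = refl
applyUpTo-cong f h (suc l) e = cong₂ _∷_ (e 0) (applyUpTo-cong (λ j → f (suc j)) (λ j → h (suc j)) l (λ j → e (suc j)))

applyUpTo-interval : ∀ (f : ℕ → ℕ) b l → (∀ t → f t ≡ b + t) → applyUpTo f l ≡ interval b l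
applyUpTo-interval f b zero    h = refl
applyUpTo-interval f b (suc l) h = cong₂ _∷_ (trans (h 0) (+-identityʳ b))
  (applyUpTo-interval (λ t → f (suc t)) (suc b) l (λ t → trans (h (suc t)) (+-suc b t)))

interval-filter : (f : X → ℕ) (P : X → Bool) (b : ℕ) (xs : List X) → map f xs ≡ interval b (length xs) →
  map f (filterᵇ P xs) ≡ applyUpTo (λ j → b + nthIndex P xs j) (length (filterᵇ P xs))
interval-filter f P b [] e = refl
interval-filter f P b (x ∷ xs) e with ∷-injective e
... | e₁ , e₂ with P x
...   | true  = cong₂ _∷_ (trans e₁ (sym (+-identityʳ b)))
                  (trans (interval-filter f P (suc b) xs e₂) (applyUpTo-cong _ _ _ (λ j → sym (+-suc b (nthIndex P xs j)))))
...   | false = trans (interval-filter f P (suc b) xs e₂) (applyUpTo-cong _ _ _ (λ j → sym (+-suc b (nthIndex P xs j))))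

nthIndex-map : ∀ {Y : Set} (P : Y → Bool) (f : X → Y) (xs : List X) j → nthIndex P (map f xs) j ≡ nthIndex (λ x → P (f x)) xs j
nthIndex-map P f []       j = refl
nthIndex-map P f (x ∷ xs) j with P (f x) | j
... | true  | zero   = refl
... | true  | suc j′ = cong suc (nthIndex-map P f xs j′)
... | false | j′     = cong suc (nthIndex-map P f xs j′)

nthIndex-cong : (P Q : X → Bool) (xs : List X) → All (λ x → P x ≡ Q x) xs → ∀ j → nthIndex P xs j ≡ nthIndex Q xs j
nthIndex-cong P Q []       []      j = refl
nthIndex-cong P Q (x ∷ xs) (e ∷ a) j rewrite e with Q x | j
... | true  | zero   = refl
... | true  | suc j′ = cong suc (nthIndex-cong P Q xs a j′)
... | false | j′     = cong suc (nthIndex-cong P Q xs a j′)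

colour : (X → Bool) → X → DSym
colour c x = if c x then ○ else ●

no♯-colour : (c : X → Bool) (xs : List X) → NoSharp (map (colour c) xs)
no♯-colour c []       = []
no♯-colour c (x ∷ xs) with c x
... | true  = (λ ()) ∷ no♯-colour c xs
... | false = (λ ()) ∷ no♯-colour c xs

afterWhitePrefix-white : (c : X → Bool) (xs : List X) → All (λ x → c x ≡ true) xs → afterWhitePrefix (map (colour c) xs) ≡ []
afterWhitePrefix-white c []       []      = refl
afterWhitePrefix-white c (x ∷ xs) (e ∷ a) rewrite e = afterWhitePrefix-white c xs a

interleave-colour : (c : X → Bool) (f : X → ℕ) (W B : ℕ → ℕ) (xs : List X) →
  map f (filterᵇ c xs) ≡ applyUpTo W (length (filterᵇ c xs)) →
  map f (filterᵇ (λ x → not (c x)) xs) ≡ applyUpTo B (length (filterᵇ (λ x → not (c x)) xs)) →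
  map f xs ≡ interleave W B (map (colour c) xs)
interleave-colour c f W B [] _ _ = refl
interleave-colour c f W B (x ∷ xs) whites blacks with c x
... | true with ∷-injective whites
...   | h , t = cong₂ _∷_ h (interleave-colour c f (λ j → W (suc j)) B xs t blacks)
interleave-colour c f W B (x ∷ xs) whites blacks | false with ∷-injective blacks
...   | h , t = cong₂ _∷_ h (interleave-colour c f W (λ j → B (suc j)) xs whites t)

interleave-shift : ∀ q W B E → map (q +_) (interleave W B E) ≡ interleave (λ j → q + W j) (λ j → q + B j) E
interleave-shift q W B []      = refl
interleave-shift q W B (○ ∷ E) = cong (q + W 0 ∷_) (interleave-shift q (λ j → W (suc j)) B E)
interleave-shift q W B (● ∷ E) = cong (q + B 0 ∷_) (interleave-shift q W (λ j → B (suc j)) E)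
interleave-shift q W B (♯ ∷ E) = interleave-shift q W B E

-- An injective map of Fin n to itself is onto (pigeonhole principle).
surjective : ∀ {n} (σ : Fin n → Fin n) → Injective _≡_ _≡_ σ → ∀ w → Σ (Fin n) λ p → σ p ≡ w
surjective {zero}  σ inj ()
surjective {suc m} σ inj w with FinP.any? (λ p → σ p FinP.≟ w)
... | yes hit = hit
... | no miss with FinP.pigeonhole (n<1+n m) (λ p → F.punchOut {i = w} {j = σ p} (λ eq → miss (p , sym eq)))
...   | i , j , i<j , e = ⊥-elim (<-irrefl (cong toℕ (inj
        (FinP.punchOut-injective {i = w} (λ eq → miss (i , sym eq)) (λ eq → miss (j , sym eq)) e))) i<j)

filter-single : ∀ {n} (P : Fin n → Bool) (xs : List (Fin n)) (y : Fin n) → Increasing xs → y ∈ xs →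
  P y ≡ true → (∀ x → P x ≡ true → x ≡ y) → filterᵇ P xs ≡ y ∷ []
filter-single P xs y xs↑ y∈ Py unique =
  increasing-unique _ _ (AllPairs.filter⁺ _ xs↑) ([] ∷ [])
    (λ z∈ → here (unique _ (proj₂ (∈-filter⁻ P xs z∈))))
    (λ { (here refl) → ∈-filter⁺ P y∈ Py })

2*suc : ∀ i → 2 * suc i ≡ suc (suc (2 * i))
2*suc i = *-suc 2 i

isEven-2* : ∀ i → isEven (2 * i) ≡ true
isEven-2* zero    = refl
isEven-2* (suc i) = trans (cong isEven (2*suc i)) (trans (not-involutive (isEven (2 * i))) (isEven-2* i))

isEven-suc-2* : ∀ i → isEven (suc (2 * i)) ≡ false
isEven-suc-2* i = cong not (isEven-2* i)

straddle : ∀ a b T → a < T → T ≤ b → (a + 2 ≤ b) ⊎ ((b ≡ T) × (suc a ≡ T))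
straddle a b T a<T T≤b with (a + 2) Data.Nat.≤? b
... | yes far = inj₁ far
... | no near = inj₂ (≤-antisym (≤-trans b≤1+a a<T) T≤b , ≤-antisym a<T (≤-trans T≤b b≤1+a))
  where
    b≤1+a : b ≤ suc a
    b≤1+a = ≤-pred (≤-trans (≰⇒> near) (≤-reflexive (+-comm a 2)))

window : ∀ a T → (not (a <ᵇ T) ∧ (a <ᵇ suc (suc T))) ≡ ((a ≡ᵇ T) ∨ (a ≡ᵇ suc T))
window zero          zero    = refl
window zero          (suc T) = refl
window (suc zero)    zero    = refl
window (suc (suc a)) zero    = refl
window (suc a)       (suc T) = window a T

beyond-window : ∀ a T → (not (a <ᵇ T) ∧ not (a <ᵇ suc (suc T))) ≡ not (a <ᵇ suc (suc T))
beyond-window zero          zero    = refl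
beyond-window zero          (suc T) = refl
beyond-window (suc zero)    zero    = refl
beyond-window (suc (suc a)) zero    = refl
beyond-window (suc a)       (suc T) = beyond-window a T

below-window : ∀ a T → ((a <ᵇ suc (suc T)) ∧ (a <ᵇ T)) ≡ (a <ᵇ T)
below-window zero          zero    = refl
below-window zero          (suc T) = refl
below-window (suc zero)    zero    = refl
below-window (suc (suc a)) zero    = refl
below-window (suc a)       (suc T) = below-window a T

window′ : ∀ a T → ((a <ᵇ suc (suc T)) ∧ not (a <ᵇ T)) ≡ ((a ≡ᵇ T) ∨ (a ≡ᵇ suc T))
window′ a T = trans (∧-comm (a <ᵇ suc (suc T)) _) (window a T)

-- Block i consists of the
-- cells 2i and 2i+1.  In position order, cells below 2i come before cells
-- 2i and above; in value order, cells below 2i-1 come before cells 2i-1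
-- and above.  Hence the blocks are contiguous by position, and the values
-- of block i are determined by base i (the number of entries below cell
-- 2i-1) together with the dominoes d_{2i-1}, d_{2i}, d_{2i+1}.
module Gridding (n : ℕ) (σ : Fin n → Fin n) (inj : IsPerm n σ)
                (g : Fin n → ℕ) (gr : StaircaseGridding n σ g) where

  open StaircaseGridding gr
  open DyckOfValues n σ using (value)

  byVal : List (Fin n)
  byVal = byValue n σ

  preimage : Fin n → Fin n
  preimage w = proj₁ (surjective σ inj w)

  value-slot : ∀ w → filterᵇ (λ p → toℕ (σ p) ≡ᵇ toℕ w) (allFin n) ≡ preimage w ∷ []
  value-slot w = filter-single _ (allFin n) (preimage w) (allFin-increasing n) (∈-allFin (preimage w))
    (≡ᵇ-true _ _ (cong toℕ (proj₂ (surjective σ inj w))))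
    (λ p e → inj (trans (FinP.toℕ-injective (≡ᵇ-true⁻ _ _ e)) (sym (proj₂ (surjective σ inj w)))))

  byVal-values : map value byVal ≡ interval 1 (length byVal)
  byVal-values = trans values (cong (interval 1) (sym length-byVal))
    where
      values : map value byVal ≡ interval 1 n
      values = begin
          map value (concatMap (λ w → filterᵇ (λ p → toℕ (σ p) ≡ᵇ toℕ w) (allFin n)) (allFin n))
        ≡⟨ map-concatMap value (λ w → filterᵇ (λ p → toℕ (σ p) ≡ᵇ toℕ w) (allFin n)) (allFin n) ⟩
          concatMap (λ w → map value (filterᵇ (λ p → toℕ (σ p) ≡ᵇ toℕ w) (allFin n))) (allFin n)
        ≡⟨ concatMap-cong (λ w → cong (map value) (value-slot w)) (allFin n) ⟩
          concatMap (λ w → value (preimage w) ∷ []) (allFin n)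
        ≡⟨ concatMap-cong (λ w → cong (λ x → suc (toℕ x) ∷ []) (proj₂ (surjective σ inj w))) (allFin n) ⟩
          concatMap (λ w → suc (toℕ w) ∷ []) (allFin n)
        ≡⟨ sym (concatMap-map [_] (λ w → suc (toℕ w)) (allFin n)) ⟩
          concatMap [_] (map (λ w → suc (toℕ w)) (allFin n))
        ≡⟨ concatMap-pure _ ⟩
          map (λ w → suc (toℕ w)) (allFin n)
        ≡⟨ allFin-interval n ⟩
          interval 1 n ∎
        where open ≡-Reasoning
      length-byVal : length byVal ≡ n
      length-byVal = trans (sym (length-map value byVal)) (trans (cong length values) (length-interval 1 n))

  ∈-byVal : ∀ p → p ∈ byVal
  ∈-byVal p = ∈-concatMap-intro _ (∈-allFin (σ p)) (∈-filter⁺ (λ q → toℕ (σ q) ≡ᵇ toℕ (σ p)) (∈-allFin p) (≡ᵇ-true (toℕ (σ p)) _ refl))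

  byVal-increasing : AllPairs (λ p q → toℕ (σ p) < toℕ (σ q)) byVal
  byVal-increasing = AllPairs.map ≤-pred (interval-sorted value byVal byVal-values)

  -- By position, cells below 2i precede the others (staircase conditions:
  -- a cell at least two labels higher is to the right; cell 2i is to the
  -- right of cell 2i-1).
  earlier-cells-first : ∀ i p q → toℕ p < toℕ q → (g q <ᵇ 2 * i) ≡ true → (g p <ᵇ 2 * i) ≡ true
  earlier-cells-first i p q p<q gq<2i with g p <ᵇ 2 * i in gp<2i
  ... | true  = refl
  ... | false with straddle (g q) (g p) (2 * i) (<ᵇ-true⁻ _ _ gq<2i) (<ᵇ-false⁻ _ _ gp<2i)
  ...   | inj₁ far = ⊥-elim (<-asym p<q (proj₁ (farAboveRight (g q) (g p) far q p refl refl)))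
  ...   | inj₂ (gp≡2i , gq+1≡2i) = ⊥-elim (<-asym p<q (evenRight i (1≤i (g q) gq+1≡2i) q p (cong (_∸ 1) gq+1≡2i) gp≡2i))
    where
      1≤i : ∀ {i} a → suc a ≡ 2 * i → 1 ≤ i
      1≤i {suc i} a _ = s≤s z≤n

  -- By value, cells below 2i-1 precede the others (a cell at least two
  -- labels higher is above; cell 2i+1 is above cell 2i).
  lower-cells-first : ∀ i p q → toℕ (σ p) < toℕ (σ q) → (suc (g q) <ᵇ 2 * i) ≡ true → (suc (g p) <ᵇ 2 * i) ≡ true
  lower-cells-first i p q σp<σq gq+1<2i with suc (g p) <ᵇ 2 * i in gp+1<2i
  ... | true  = refl
  ... | false with straddle (suc (g q)) (suc (g p)) (2 * i) (<ᵇ-true⁻ _ _ gq+1<2i) (<ᵇ-false⁻ _ _ gp+1<2i)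
  ...   | inj₁ far = ⊥-elim (<-asym σp<σq (proj₂ (farAboveRight (g q) (g p) (≤-pred far) q p refl refl)))
  ...   | inj₂ (gp+1≡2i , gq+2≡2i) = ⊥-elim (<-asym σp<σq (odd-above i gp+1≡2i gq+2≡2i))
    where
      odd-above : ∀ i → suc (g p) ≡ 2 * i → suc (suc (g q)) ≡ 2 * i → toℕ (σ q) < toℕ (σ p)
      odd-above (suc j) e₁ e₂ = oddAbove j 1≤j q p gq≡2j gp≡2j+1
        where
          gq≡2j : g q ≡ 2 * j
          gq≡2j = suc-injective (suc-injective (trans e₂ (2*suc j)))
          gp≡2j+1 : g p ≡ 2 * j + 1
          gp≡2j+1 = trans (suc-injective (trans e₁ (2*suc j))) (+-comm 1 (2 * j))
          half : ∀ j → 1 ≤ 2 * j → 1 ≤ j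
          half (suc j) _ = s≤s z≤n
          1≤j : 1 ≤ j
          1≤j = half j (subst (1 ≤_) gq≡2j (positive q))

  cell-increasing : ∀ c a b → (g a ≡ᵇ c) ≡ true → (g b ≡ᵇ c) ≡ true → toℕ (σ a) < toℕ (σ b) → toℕ a < toℕ b
  cell-increasing c a b ga≡c gb≡c σa<σb with FinP.<-cmp a b
  ... | tri< a<b _ _ = a<b
  ... | tri≈ _ refl _ = ⊥-elim (<-irrefl refl σa<σb)
  ... | tri> _ _ b<a = ⊥-elim (<-asym σa<σb (increasing b a (trans (≡ᵇ-true⁻ _ _ gb≡c) (sym (≡ᵇ-true⁻ _ _ ga≡c))) b<a))

  cell-byVal : ∀ c → filterᵇ (λ p → g p ≡ᵇ c) byVal ≡ filterᵇ (λ p → g p ≡ᵇ c) (allFin n)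
  cell-byVal c = increasing-unique _ _ byVal-cell↑ (AllPairs.filter⁺ _ (allFin-increasing n))
    (λ p∈ → ∈-filter⁺ inCell (∈-allFin _) (proj₂ (∈-filter⁻ inCell byVal p∈)))
    (λ p∈ → ∈-filter⁺ inCell (∈-byVal _) (proj₂ (∈-filter⁻ inCell (allFin n) p∈)))
    where
      inCell = λ p → g p ≡ᵇ c
      byVal-cell↑ : Increasing (filterᵇ inCell byVal)
      byVal-cell↑ = AllPairs-restrict (filter-satisfies inCell byVal) (AllPairs.filter⁺ _ byVal-increasing) (cell-increasing c)

  leftPart rightPart block : ℕ → List (Fin n)
  leftPart i  = filterᵇ (λ p → g p <ᵇ 2 * i) (allFin n)
  rightPart i = filterᵇ (λ p → not (g p <ᵇ 2 * i)) (allFin n)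
  block i     = filterᵇ (λ p → (g p ≡ᵇ 2 * i) ∨ (g p ≡ᵇ suc (2 * i))) (allFin n)

  -- By value: the cells below 2i-1, the cells from 2i-1 on, and the cells
  -- 2i-1 and 2i (those of the domino d_{2i-1}).
  lowPart highPart oddPair : ℕ → List (Fin n)
  lowPart i  = filterᵇ (λ p → suc (g p) <ᵇ 2 * i) byVal
  highPart i = filterᵇ (λ p → not (suc (g p) <ᵇ 2 * i)) byVal
  oddPair i  = filterᵇ (λ p → (suc (g p) ≡ᵇ 2 * i) ∨ (g p ≡ᵇ 2 * i)) byVal

  leftPart-closed : ∀ i → AllPairs (λ p q → (g q <ᵇ 2 * i) ≡ true → (g p <ᵇ 2 * i) ≡ true) (allFin n)
  leftPart-closed i = AllPairs.map (λ {p} {q} → earlier-cells-first i p q) (allFin-increasing n)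

  lowPart-closed : ∀ i → AllPairs (λ p q → (suc (g q) <ᵇ 2 * i) ≡ true → (suc (g p) <ᵇ 2 * i) ≡ true) byVal
  lowPart-closed i = AllPairs.map (λ {p} {q} → lower-cells-first i p q) byVal-increasing

  rightPart-split : ∀ i → rightPart i ≡ block i ++ rightPart (suc i)
  rightPart-split i = filter-split′ (allFin n) _ (λ p → g p <ᵇ 2 * suc i) _ _
    (AllPairs.filter⁺ _ (leftPart-closed (suc i)))
    (λ p → subst (λ T → (not (g p <ᵇ 2 * i) ∧ (g p <ᵇ T)) ≡ ((g p ≡ᵇ 2 * i) ∨ (g p ≡ᵇ suc (2 * i)))) (sym (2*suc i)) (window (g p) (2 * i)))
    (λ p → subst (λ T → (not (g p <ᵇ 2 * i) ∧ not (g p <ᵇ T)) ≡ not (g p <ᵇ T)) (sym (2*suc i)) (beyond-window (g p) (2 * i)))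

  leftPart-split : ∀ i → leftPart (suc i) ≡ leftPart i ++ block i
  leftPart-split i = filter-split′ (allFin n) _ (λ p → g p <ᵇ 2 * i) _ _
    (AllPairs.filter⁺ _ (leftPart-closed i))
    (λ p → subst (λ T → ((g p <ᵇ T) ∧ (g p <ᵇ 2 * i)) ≡ (g p <ᵇ 2 * i)) (sym (2*suc i)) (below-window (g p) (2 * i)))
    (λ p → subst (λ T → ((g p <ᵇ T) ∧ not (g p <ᵇ 2 * i)) ≡ ((g p ≡ᵇ 2 * i) ∨ (g p ≡ᵇ suc (2 * i)))) (sym (2*suc i)) (window′ (g p) (2 * i)))

  byVal-split : ∀ i → byVal ≡ lowPart i ++ highPart i
  byVal-split i = filter-split (λ p → suc (g p) <ᵇ 2 * i) byVal (lowPart-closed i)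

  highPart-split : ∀ i → highPart i ≡ oddPair i ++ highPart (suc i)
  highPart-split i = filter-split′ byVal _ (λ p → suc (g p) <ᵇ 2 * suc i) _ _
    (AllPairs.filter⁺ _ (lowPart-closed (suc i)))
    (λ p → subst (λ T → (not (suc (g p) <ᵇ 2 * i) ∧ (suc (g p) <ᵇ T)) ≡ ((suc (g p) ≡ᵇ 2 * i) ∨ (g p ≡ᵇ 2 * i))) (sym (2*suc i)) (window (suc (g p)) (2 * i)))
    (λ p → subst (λ T → (not (suc (g p) <ᵇ 2 * i) ∧ not (suc (g p) <ᵇ T)) ≡ not (suc (g p) <ᵇ T)) (sym (2*suc i))
             (beyond-window (suc (g p)) (2 * i)))

  lowPart-split : ∀ i → lowPart (suc i) ≡ lowPart i ++ oddPair i
  lowPart-split i = filter-split′ byVal _ (λ p → suc (g p) <ᵇ 2 * i) _ _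
    (AllPairs.filter⁺ _ (lowPart-closed i))
    (λ p → subst (λ T → ((suc (g p) <ᵇ T) ∧ (suc (g p) <ᵇ 2 * i)) ≡ (suc (g p) <ᵇ 2 * i)) (sym (2*suc i))
             (below-window (suc (g p)) (2 * i)))
    (λ p → subst (λ T → ((suc (g p) <ᵇ T) ∧ not (suc (g p) <ᵇ 2 * i)) ≡ ((suc (g p) ≡ᵇ 2 * i) ∨ (g p ≡ᵇ 2 * i))) (sym (2*suc i)) (window′ (suc (g p)) (2 * i)))

  base : ℕ → ℕ
  base i = length (lowPart i)

  lowPart-values : ∀ i → map value (lowPart i) ≡ interval 1 (base i)
  lowPart-values i = proj₁ (interval-split value 1 (lowPart i) (highPart i)
    (subst (λ xs → map value xs ≡ interval 1 (length xs)) (byVal-split i) byVal-values))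

  oddPair-values : ∀ i → map value (oddPair i) ≡ interval (suc (base i)) (length (oddPair i))
  oddPair-values i = proj₁ (interval-split value (suc (base i)) (oddPair i) (highPart (suc i))
    (subst (λ xs → map value xs ≡ interval (suc (base i)) (length xs)) (highPart-split i)
      (proj₂ (interval-split value 1 (lowPart i) (highPart i)
        (subst (λ xs → map value xs ≡ interval 1 (length xs)) (byVal-split i) byVal-values)))))

  base-suc : ∀ i → base (suc i) ≡ base i + length (oddPair i)
  base-suc i = trans (cong length (lowPart-split i)) (length-++ (lowPart i))

  height : ℕ → ℕ
  height i = runMax 0 (map value (leftPart i))

  -- the entry of value base i lies in a cell below 2i-1, hence before block i
  base≤height : ∀ i → base i ≤ height i
  base≤height i = top (base i) (lowPart-values i)
    where
      top : ∀ q → map value (lowPart i) ≡ interval 1 q → q ≤ height i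
      top zero    _      = z≤n
      top (suc l) values with ∈-map⁻ value (subst (suc l ∈_) (sym values) (interval-last 1 l))
      ... | p , p∈ , refl = runMax-∈ 0 (map value (leftPart i)) (∈-map⁺ value
              (∈-filter⁺ _ (∈-allFin p) (<ᵇ-true {g p} {2 * i} (≤-trans (n≤1+n (suc (g p))) (<ᵇ-true⁻ (suc (g p)) (2 * i) (proj₂ (∈-filter⁻ _ byVal p∈)))))))

  -- every entry before block i lies in a cell below 2i+1
  height≤base-suc : ∀ i → height i ≤ base (suc i)
  height≤base-suc i = runMax-lub 0 (map value (leftPart i)) z≤n (All.map⁺ (All.tabulate bounded))
    where
      bounded : ∀ {p} → p ∈ leftPart i → value p ≤ base (suc i)
      bounded {p} p∈ = ≤-pred (interval-upper 1 (base (suc i)) (subst (value p ∈_) (lowPart-values (suc i)) (∈-map⁺ value p∈low)))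
        where
          p∈low : p ∈ lowPart (suc i)
          p∈low = ∈-filter⁺ _ (∈-byVal p) (subst (λ T → (suc (g p) <ᵇ T) ≡ true) (sym (2*suc i))
                    (<ᵇ-true (s≤s (≤-trans (<ᵇ-true⁻ (g p) (2 * i) (proj₂ (∈-filter⁻ _ (allFin n) p∈))) (n≤1+n (2 * i))))))

  offset : ℕ → ℕ
  offset i = height i ∸ base i

  height≡base+offset : ∀ i → height i ≡ base i + offset i
  height≡base+offset i = sym (m+[n∸m]≡n (base≤height i))

  offset≤ : ∀ i → offset i ≤ length (oddPair i)
  offset≤ i = ≤-trans (∸-monoˡ-≤ (base i) (height≤base-suc i))
                      (≤-reflexive (trans (cong (_∸ base i) (base-suc i)) (m+n∸m≡n (base i) _)))

  -- The odd dominoes, with d_{-1} empty.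
  oddDomino : ℕ → List DSym
  oddDomino zero    = []
  oddDomino (suc i) = domino n σ g (suc (2 * i))

  oddDomino-colours : ∀ i → oddDomino i ≡ map (colour (λ p → suc (g p) ≡ᵇ 2 * i)) (oddPair i)
  oddDomino-colours zero = sym (cong (map _) (filter-none _ byVal (All.tabulate λ {p} _ → no-cell-0 p)))
    where
      no-cell-0 : ∀ p → ((suc (g p) ≡ᵇ 0) ∨ (g p ≡ᵇ 0)) ≡ false
      no-cell-0 p with g p | positive p
      ... | suc _ | _ = refl
  oddDomino-colours (suc i) = by-value (2 * suc i) (2*suc i)
    where
      by-value : ∀ T → T ≡ suc (suc (2 * i)) →
        domino n σ g (suc (2 * i)) ≡ map (colour (λ p → suc (g p) ≡ᵇ T)) (filterᵇ (λ p → (suc (g p) ≡ᵇ T) ∨ (g p ≡ᵇ T)) byVal)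
      by-value T refl rewrite isEven-suc-2* i = refl

  evenDomino-colours : ∀ i → domino n σ g (2 * i) ≡ map (colour (λ p → g p ≡ᵇ 2 * i)) (block i)
  evenDomino-colours i rewrite isEven-2* i = refl

  length-oddDomino : ∀ i → length (oddDomino i) ≡ length (oddPair i)
  length-oddDomino i = trans (cong length (oddDomino-colours i)) (length-map _ (oddPair i))

  length-domino : ∀ j → length (domino n σ g j) ≤ cellSize n g j + cellSize n g (suc j)
  length-domino j rewrite length-map (colour (λ p → g p ≡ᵇ j))
      (filterᵇ (λ p → (g p ≡ᵇ j) ∨ (g p ≡ᵇ suc j)) (if isEven j then allFin n else byVal)) with isEven j
  ... | true  = length-filter-∨ (λ p → g p ≡ᵇ j) (λ p → g p ≡ᵇ suc j) (allFin n)
  ... | false = subst₂ (λ a b → length (filterᵇ (λ p → (g p ≡ᵇ j) ∨ (g p ≡ᵇ suc j)) byVal) ≤ length a + length b)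
                  (cell-byVal j) (cell-byVal (suc j))
                  (length-filter-∨ (λ p → g p ≡ᵇ j) (λ p → g p ≡ᵇ suc j) byVal)

  inEven inUpper inBlock inOddPair : ℕ → Fin n → Bool
  inEven i p    = g p ≡ᵇ 2 * i
  inUpper i p   = g p ≡ᵇ suc (2 * i)
  inBlock i p   = (g p ≡ᵇ 2 * i) ∨ (g p ≡ᵇ suc (2 * i))
  inOddPair i p = (suc (g p) ≡ᵇ 2 * i) ∨ (g p ≡ᵇ 2 * i)

  cell-2i : ∀ i → filterᵇ (inEven i) (block i) ≡ filterᵇ (inEven i) (oddPair i)
  cell-2i i = trans (filter-weaker (inBlock i) (inEven i) (allFin n) (λ p e → cong (_∨ (g p ≡ᵇ suc (2 * i))) e))
             (trans (sym (cell-byVal (2 * i)))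
                    (sym (filter-weaker (inOddPair i) (inEven i) byVal (λ p e → trans (cong ((suc (g p) ≡ᵇ 2 * i) ∨_) e) (∨-zeroʳ _)))))

  cell-2i+1 : ∀ i → filterᵇ (λ p → not (inEven i p)) (block i) ≡ filterᵇ (inUpper i) (oddPair (suc i))
  cell-2i+1 i = trans (filter-cong _ (inUpper i) (block i) (All.map (λ {p} → not-even p) (filter-satisfies (inBlock i) (allFin n))))
               (trans (filter-weaker (inBlock i) (inUpper i) (allFin n) (λ p e → trans (cong ((g p ≡ᵇ 2 * i) ∨_) e) (∨-zeroʳ _)))
               (trans (sym (cell-byVal (suc (2 * i))))
                      (sym (filter-weaker (inOddPair (suc i)) (inUpper i) byVal upper-in-pair))))
    where
      not-even : ∀ p → inBlock i p ≡ true → not (inEven i p) ≡ inUpper i p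
      not-even p e with g p ≡ᵇ 2 * i in e₁ | g p ≡ᵇ suc (2 * i) in e₂
      ... | true  | true  = ⊥-elim (<-irrefl (trans (sym (≡ᵇ-true⁻ (g p) (2 * i) e₁)) (≡ᵇ-true⁻ (g p) (suc (2 * i)) e₂)) (n<1+n (2 * i)))
      ... | true  | false = refl
      ... | false | true  = refl
      upper-in-pair : ∀ p → inUpper i p ≡ true → inOddPair (suc i) p ≡ true
      upper-in-pair p e = subst (λ T → ((suc (g p) ≡ᵇ T) ∨ (g p ≡ᵇ T)) ≡ true) (sym (2*suc i))
                            (cong (_∨ (g p ≡ᵇ suc (suc (2 * i)))) e)

  cell-2i-values : ∀ i → map value (filterᵇ (inEven i) (block i)) ≡
                   applyUpTo (λ j → base i + lowerValue (oddDomino i) j) (length (filterᵇ (inEven i) (block i)))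
  cell-2i-values i rewrite cell-2i i =
    trans (interval-filter value (inEven i) (suc (base i)) (oddPair i) (oddPair-values i)) (applyUpTo-cong _ _ _ index)
    where
      black-is-2i : ∀ {p} → inOddPair i p ≡ true → isBlack (colour (λ p → suc (g p) ≡ᵇ 2 * i) p) ≡ inEven i p
      black-is-2i {p} e with suc (g p) ≡ᵇ 2 * i in e₁ | g p ≡ᵇ 2 * i in e₂
      ... | true  | true  = ⊥-elim (<-irrefl (trans (≡ᵇ-true⁻ (g p) (2 * i) e₂) (sym (≡ᵇ-true⁻ (suc (g p)) (2 * i) e₁))) (n<1+n (g p)))
      ... | true  | false = refl
      ... | false | true  = refl
      index : ∀ j → suc (base i) + nthIndex (inEven i) (oddPair i) j ≡ base i + lowerValue (oddDomino i) j
      index j = trans (sym (+-suc (base i) _)) (cong (λ x → base i + suc x) (sym (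
                  trans (cong (λ D → nthIndex isBlack D j) (oddDomino-colours i))
                  (trans (nthIndex-map isBlack _ (oddPair i) j)
                         (nthIndex-cong _ (inEven i) (oddPair i) (All.map black-is-2i (filter-satisfies (inOddPair i) byVal)) j)))))

  cell-2i+1-values : ∀ i → map value (filterᵇ (λ p → not (inEven i p)) (block i)) ≡
    applyUpTo (λ j → base i + upperValue (oddDomino i) (oddDomino (suc i)) j) (length (filterᵇ (λ p → not (inEven i p)) (block i)))
  cell-2i+1-values i rewrite cell-2i+1 i =
    trans (interval-filter value (inUpper i) (suc (base (suc i))) (oddPair (suc i)) (oddPair-values (suc i)))
          (applyUpTo-cong _ _ _ index)
    where
      white-is-2i+1 : ∀ p → isWhite (colour (λ p → suc (g p) ≡ᵇ 2 * suc i) p) ≡ inUpper i p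
      white-is-2i+1 p = at (2 * suc i) (2*suc i)
        where
          at : ∀ T → T ≡ suc (suc (2 * i)) → isWhite (colour (λ p → suc (g p) ≡ᵇ T) p) ≡ inUpper i p
          at T refl with g p ≡ᵇ suc (2 * i)
          ... | true  = refl
          ... | false = refl
      index : ∀ j → suc (base (suc i)) + nthIndex (inUpper i) (oddPair (suc i)) j ≡
                    base i + upperValue (oddDomino i) (oddDomino (suc i)) j
      index j rewrite base-suc i | length-oddDomino i | oddDomino-colours (suc i)
                    | nthIndex-map isWhite (colour (λ p → suc (g p) ≡ᵇ 2 * suc i)) (oddPair (suc i)) j
                    | nthIndex-cong (λ p → isWhite (colour (λ p → suc (g p) ≡ᵇ 2 * suc i) p)) (inUpper i) (oddPair (suc i))
                        (All.tabulate λ {p} _ → white-is-2i+1 p) j =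
        trans (cong suc (+-assoc (base i) (length (oddPair i)) _)) (sym (+-suc (base i) _))

  block-values : ∀ i → map value (block i) ≡
    map (base i +_) (interleave (lowerValue (oddDomino i)) (upperValue (oddDomino i) (oddDomino (suc i))) (domino n σ g (2 * i)))
  block-values i rewrite evenDomino-colours i =
    trans (interleave-colour (inEven i) value _ _ (block i) (cell-2i-values i) (cell-2i+1-values i))
          (sym (interleave-shift (base i) (lowerValue (oddDomino i)) (upperValue (oddDomino i) (oddDomino (suc i)))
                 (map (colour (inEven i)) (block i))))

foldr-⊔-upper : ∀ {x} xs → x ∈ xs → x ≤ foldr _⊔_ 0 xs
foldr-⊔-upper (y ∷ xs) (here refl) = m≤m⊔n y _
foldr-⊔-upper (y ∷ xs) (there x∈)  = ≤-trans (foldr-⊔-upper xs x∈) (m≤n⊔m y _)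

-- Invariant: before block i it is in
-- blockState i, and it writes the walk of the values of block i, shifted
-- down by base i, while reading d_{2i} ♯ d_{2i+1} ♯.
module Simulation (k n : ℕ) (σ : Fin n → Fin n) (inj : IsPerm n σ) (g : Fin n → ℕ)
                  (gr : StaircaseGridding n σ g) (small : (c : ℕ) → cellSize n g c ≤ k) where

  open Gridding n σ inj g gr
  open DyckOfValues n σ using (value; dyckEncoding-walk)
  open Bounded (k + k)

  dom : ℕ → List DSym
  dom j = domino n σ g j

  m : ℕ
  m = maxLabel n g

  label≤m : ∀ p → g p ≤ m
  label≤m p = foldr-⊔-upper (map g (allFin n)) (∈-map⁺ g (∈-allFin p))

  dominoesFrom : ℕ → ℕ → List DSym
  dominoesFrom j c = concatMap (λ t → dom t ++ ♯ ∷ []) (interval j c)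

  -- with at most k entries per cell, nothing the machine stores exceeds 2k
  dom-fits : ∀ j → length (dom j) ≤ k + k
  dom-fits j = ≤-trans (length-domino j) (+-mono-≤ (small j) (small (suc j)))

  oddDomino-fits : ∀ i → length (oddDomino i) ≤ k + k
  oddDomino-fits zero    = z≤n
  oddDomino-fits (suc i) = dom-fits (suc (2 * i))

  offset-fits : ∀ i → offset i ≤ k + k
  offset-fits i = ≤-trans (offset≤ i) (≤-trans (≤-reflexive (sym (length-oddDomino i))) (oddDomino-fits i))

  blockState : ℕ → State
  blockState i = state even (oddDomino i) [] [] (offset i)

  blockWord : ℕ → List ℕ
  blockWord i = interleave (lowerValue (oddDomino i)) (upperValue (oddDomino i) (oddDomino (suc i))) (dom (2 * i))

  blockWord-split : ∀ i → blockWord i ≡ prefixValues (oddDomino i) (dom (2 * i)) ++ restValues (oddDomino i) (dom (2 * i)) (oddDomino (suc i))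
  blockWord-split i = interleave-split _ _ (λ _ → 0) (dom (2 * i))

  walk-block : ∀ i → walk (height i) (map value (block i)) ≡ walk (offset i) (blockWord i)
  walk-block i = trans (cong₂ walk (height≡base+offset i) (block-values i)) (walk-shift (base i) (offset i) (blockWord i))

  height-suc : ∀ i → height (suc i) ≡ runMax (height i) (map value (block i))
  height-suc i = trans (cong (λ xs → runMax 0 (map value xs)) (leftPart-split i))
                 (trans (cong (runMax 0) (map-++ value (leftPart i) (block i))) (runMax-++ 0 (map value (leftPart i)) (map value (block i))))

  offset-suc : ∀ i → offset (suc i) ≡
    runMax (runMax (offset i) (prefixValues (oddDomino i) (dom (2 * i)))) (restValues (oddDomino i) (dom (2 * i)) (oddDomino (suc i)))
      ∸ length (oddDomino i)
  offset-suc i = begin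
      height (suc i) ∸ base (suc i)
    ≡⟨ cong₂ _∸_ (trans (height-suc i) (trans (cong₂ runMax (height≡base+offset i) (block-values i))
                   (runMax-shift (base i) (offset i) (blockWord i)))) (base-suc i) ⟩
      (base i + runMax (offset i) (blockWord i)) ∸ (base i + length (oddPair i))
    ≡⟨ [m+n]∸[m+o]≡n∸o (base i) _ _ ⟩
      runMax (offset i) (blockWord i) ∸ length (oddPair i)
    ≡⟨ cong₂ _∸_ (trans (cong (runMax (offset i)) (blockWord-split i))
         (runMax-++ (offset i) (prefixValues (oddDomino i) (dom (2 * i))) (restValues (oddDomino i) (dom (2 * i)) (oddDomino (suc i))))) (sym (length-oddDomino i)) ⟩
      _ ∎
    where open ≡-Reasoning

  no♯-dom : ∀ j → NoSharp (dom j)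
  no♯-dom j = no♯-colour (λ p → g p ≡ᵇ j) _

  block-step : ∀ i → let segment = (dom (2 * i) ++ ♯ ∷ []) ++ (dom (suc (2 * i)) ++ ♯ ∷ []) in
    (output (blockState i) segment ≡ walk (height i) (map value (block i))) ×
    (finalState (blockState i) segment ≡ blockState (suc i))
  block-step i = written , reached
    where
      D = oddDomino i
      E = dom (2 * i)
      C = oddDomino (suc i)
      r = offset i
      even-part = read-even-domino D E r (no♯-dom (2 * i)) (oddDomino-fits i , dom-fits (2 * i) , z≤n , offset-fits i)
      odd-part = read-odd-domino D E C r (no♯-dom (suc (2 * i)))
                   (oddDomino-fits i , dom-fits (2 * i) , oddDomino-fits (suc i) , offset-fits i)
                   (subst (_≤ k + k) (offset-suc i) (offset-fits (suc i)))
      written : output (blockState i) ((E ++ ♯ ∷ []) ++ (C ++ ♯ ∷ [])) ≡ walk (height i) (map value (block i))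
      written = begin
          output (blockState i) ((E ++ ♯ ∷ []) ++ (C ++ ♯ ∷ []))
        ≡⟨ output-++ (blockState i) (E ++ ♯ ∷ []) (C ++ ♯ ∷ []) ⟩
          output (blockState i) (E ++ ♯ ∷ []) ++ output (finalState (blockState i) (E ++ ♯ ∷ [])) (C ++ ♯ ∷ [])
        ≡⟨ cong₂ (λ o s → o ++ output s (C ++ ♯ ∷ [])) (proj₁ even-part) (proj₂ even-part) ⟩
          walk r (prefixValues D E) ++ output (state odd D E [] r) (C ++ ♯ ∷ [])
        ≡⟨ cong (walk r (prefixValues D E) ++_) (proj₁ odd-part) ⟩
          walk r (prefixValues D E) ++ walk (runMax r (prefixValues D E)) (restValues D E C)
        ≡⟨ sym (walk-++ r (prefixValues D E) (restValues D E C)) ⟩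
          walk r (prefixValues D E ++ restValues D E C)
        ≡⟨ cong (walk r) (sym (blockWord-split i)) ⟩
          walk r (blockWord i)
        ≡⟨ sym (walk-block i) ⟩
          walk (height i) (map value (block i)) ∎
        where open ≡-Reasoning
      reached : finalState (blockState i) ((E ++ ♯ ∷ []) ++ (C ++ ♯ ∷ [])) ≡ blockState (suc i)
      reached = trans (finalState-++ (blockState i) (E ++ ♯ ∷ []) (C ++ ♯ ∷ []))
                (trans (cong (λ s → finalState s (C ++ ♯ ∷ [])) (proj₂ even-part))
                (trans (proj₂ odd-part) (cong (state even C [] []) (sym (offset-suc i)))))

  rightPart-empty : ∀ i → m < 2 * i → rightPart i ≡ []
  rightPart-empty i m<2i = filter-none _ (allFin n) (All.tabulate λ {p} _ →
    cong not (<ᵇ-true {g p} {2 * i} (≤-trans (s≤s (label≤m p)) m<2i)))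

  block-even : ∀ i → 2 * i ≡ m → All (λ p → inEven i p ≡ true) (block i)
  block-even i 2i≡m = All.map (λ {p} → in-cell-2i p) (filter-satisfies (inBlock i) (allFin n))
    where
      in-cell-2i : ∀ p → inBlock i p ≡ true → inEven i p ≡ true
      in-cell-2i p inB with g p ≡ᵇ 2 * i | g p ≡ᵇ suc (2 * i) in upper
      ... | true  | _     = refl
      ... | false | true  = ⊥-elim (<-irrefl (≡ᵇ-true⁻ (g p) (suc (2 * i)) upper)
                              (s≤s (≤-trans (label≤m p) (≤-reflexive (sym 2i≡m)))))

  -- The last domino d_m with m = 2i: its ♯ already completes block i.
  last-block : ∀ i → 2 * i ≡ m → output (blockState i) (dom (2 * i) ++ ♯ ∷ []) ≡ walk (height i) (map value (rightPart i))
  last-block i 2i≡m = begin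
      output (blockState i) (dom (2 * i) ++ ♯ ∷ [])
    ≡⟨ proj₁ (read-even-domino D E r (no♯-dom (2 * i)) (oddDomino-fits i , dom-fits (2 * i) , z≤n , offset-fits i)) ⟩
      walk r (prefixValues D E)
    ≡⟨ cong (walk r) (sym (trans (blockWord-split i) (trans (cong (prefixValues D E ++_) no-rest) (++-identityʳ _)))) ⟩
      walk r (blockWord i)
    ≡⟨ sym (walk-block i) ⟩
      walk (height i) (map value (block i))
    ≡⟨ cong (λ xs → walk (height i) (map value xs))
         (sym (trans (rightPart-split i) (trans (cong (block i ++_) (rightPart-empty (suc i) m<2i+2)) (++-identityʳ _)))) ⟩
      walk (height i) (map value (rightPart i)) ∎
    where
      open ≡-Reasoning
      D = oddDomino i
      E = dom (2 * i)
      r = offset i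
      m<2i+2 : m < 2 * suc i
      m<2i+2 = subst (_< 2 * suc i) 2i≡m (≤-trans (n≤1+n _) (≤-reflexive (sym (2*suc i))))
      no-rest : restValues D E (oddDomino (suc i)) ≡ []
      no-rest rewrite evenDomino-colours i | afterWhitePrefix-white (inEven i) (block i) (block-even i 2i≡m) = refl

  output-from : ∀ c i → 2 * i + c ≡ suc m → output (blockState i) (dominoesFrom (2 * i) c) ≡ walk (height i) (map value (rightPart i))
  output-from zero i 2i≡m+1 rewrite rightPart-empty i (≤-reflexive (trans (sym 2i≡m+1) (+-identityʳ (2 * i)))) = refl
  output-from (suc zero) i 2i+1≡m+1 =
    trans (cong (output (blockState i)) (++-identityʳ (dom (2 * i) ++ ♯ ∷ [])))
          (last-block i (suc-injective (trans (+-comm 1 (2 * i)) 2i+1≡m+1)))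
  output-from (suc (suc c)) i 2i+c+2≡m+1 = begin
      output (blockState i) ((dom (2 * i) ++ ♯ ∷ []) ++ ((dom (suc (2 * i)) ++ ♯ ∷ []) ++ rest))
    ≡⟨ cong (output (blockState i)) (sym (++-assoc (dom (2 * i) ++ ♯ ∷ []) (dom (suc (2 * i)) ++ ♯ ∷ []) rest)) ⟩
      output (blockState i) (segment ++ rest)
    ≡⟨ output-++ (blockState i) segment rest ⟩
      output (blockState i) segment ++ output (finalState (blockState i) segment) rest
    ≡⟨ cong₂ (λ o s → o ++ output s rest) (proj₁ (block-step i)) (proj₂ (block-step i)) ⟩
      walk (height i) (map value (block i)) ++ output (blockState (suc i)) rest
    ≡⟨ cong (λ j → walk (height i) (map value (block i)) ++ output (blockState (suc i)) (dominoesFrom j c)) (sym (2*suc i)) ⟩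
      walk (height i) (map value (block i)) ++ output (blockState (suc i)) (dominoesFrom (2 * suc i) c)
    ≡⟨ cong (walk (height i) (map value (block i)) ++_) (output-from c (suc i) 2i+2+c≡m+1) ⟩
      walk (height i) (map value (block i)) ++ walk (height (suc i)) (map value (rightPart (suc i)))
    ≡⟨ cong (λ h → walk (height i) (map value (block i)) ++ walk h (map value (rightPart (suc i)))) (height-suc i) ⟩
      walk (height i) (map value (block i)) ++ walk (runMax (height i) (map value (block i))) (map value (rightPart (suc i)))
    ≡⟨ sym (walk-++ (height i) (map value (block i)) (map value (rightPart (suc i)))) ⟩
      walk (height i) (map value (block i) ++ map value (rightPart (suc i)))
    ≡⟨ cong (walk (height i)) (sym (trans (cong (map value) (rightPart-split i)) (map-++ value (block i) (rightPart (suc i))))) ⟩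
      walk (height i) (map value (rightPart i)) ∎
    where
      open ≡-Reasoning
      segment = (dom (2 * i) ++ ♯ ∷ []) ++ (dom (suc (2 * i)) ++ ♯ ∷ [])
      rest = dominoesFrom (suc (suc (2 * i))) c
      2i+2+c≡m+1 : 2 * suc i + c ≡ suc m
      2i+2+c≡m+1 = trans (cong (_+ c) (2*suc i))
                     (trans (cong suc (sym (+-suc (2 * i) c))) (trans (sym (+-suc (2 * i) (suc c))) 2i+c+2≡m+1))

  encoding-output : output initialState (dominoEncoding n σ g) ≡ dyckEncoding n σ
  encoding-output = begin
      output initialState (dominoEncoding n σ g)
    ≡⟨ cong (output initialState) (cong (concatMap (λ t → dom t ++ ♯ ∷ [])) (applyUpTo-interval (λ t → t) 0 (suc m) (λ t → refl))) ⟩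
      output initialState (dominoesFrom 0 (suc m))
    ≡⟨ cong (λ s → output s (dominoesFrom 0 (suc m))) initial≡block0 ⟩
      output (blockState 0) (dominoesFrom (2 * 0) (suc m))
    ≡⟨ output-from (suc m) 0 refl ⟩
      walk (height 0) (map value (rightPart 0))
    ≡⟨ cong₂ walk height-0 (cong (map value) (filter-all _ (allFin n) (All.tabulate λ _ → refl))) ⟩
      walk 0 (map value (allFin n))
    ≡⟨ sym dyckEncoding-walk ⟩
      dyckEncoding n σ ∎
    where
      open ≡-Reasoning
      height-0 : height 0 ≡ 0
      height-0 = cong (λ xs → runMax 0 (map value xs)) (filter-none _ (allFin n) (All.tabulate λ _ → refl))
      initial≡block0 : initialState ≡ blockState 0
      initial≡block0 = cong (state even [] [] []) (sym (trans (cong (_∸ base 0) height-0) (0∸n≡0 (base 0))))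

proposition8p1 : (k : ℕ) → 1 ≤ k →
    Σ (Transducer DSym UD) λ T →
      (n : ℕ) (σ : Fin n → Fin n) → IsPerm n σ → Avoids321 n σ →
      (g : Fin n → ℕ) → StaircaseGridding n σ g →
      ((c : ℕ) → cellSize n g c ≤ k) →
      Outputs T (dominoEncoding n σ g) (dyckEncoding n σ)
      × ((o : List UD) → Outputs T (dominoEncoding n σ g) o → o ≡ dyckEncoding n σ)
proposition8p1 k _ = T , correct
  where
    open Bounded (k + k) using (T; realises)
    correct : ∀ n σ → IsPerm n σ → Avoids321 n σ → ∀ g → StaircaseGridding n σ g → (∀ c → cellSize n g c ≤ k) →
              Outputs T (dominoEncoding n σ g) (dyckEncoding n σ)
              × (∀ o → Outputs T (dominoEncoding n σ g) o → o ≡ dyckEncoding n σ)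
    correct n σ inj _ g gr small =
      subst (Outputs T (dominoEncoding n σ g)) encoding-output (proj₁ machine) ,
      λ o outputs → trans (proj₂ machine o outputs) encoding-output
      where
        open Simulation k n σ inj g gr small using (encoding-output)
        machine = realises (dominoEncoding n σ g)
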